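{- Let $s\ge1$ and let $\gamma:\mathbb{N}\to\mathbb{N}$ be a function with the following moment property in dimension $s$: for all $m,N,L\in\mathbb{N}$ and all $\alpha,\beta\in(\mathbb{N}^s)^m$ not related by a permutation with $\sum_t|\alpha_t|_1\le N$, $\sum_t|\beta_t|_1\le N$ and $\sum_tF(\alpha_t,\vec{i})=\sum_tF(\beta_t,\vec{i})$ for all $\vec{i}\in\{0,\dots,L\}^s$, one has $L<\gamma(N)$. Let $G,\tilde G$ be caterpillar graphs, both with $n$ vertices and both of diameter $k+1$ ($k\ge1$), let $f=\phi(G)$, $\tilde f=\phi(\tilde G)$, $h=\operatorname{aux}(f)$, $\tilde h=\operatorname{aux}(\tilde f)$, let $S\subset\mathbb{Z}$ be finite with $|S|=s$, and let $\ell\ge s\,\gamma(6s(n-k)+12s)$. If $d_\ell(T(D_S(h)))=d_\ell(T(D_S(\tilde h)))$, then $T(D_S(h))=T(D_S(\tilde h))$ and $D_S(f)=D_S(\tilde f)$.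
   Context: $\mathbb{N}$ includes $0$. $F(\vec{x},\vec{i})=\prod_k\binom{x_k}{i_k}$, $|\vec x|_1=\sum_k|x_k|$; $\alpha,\beta\in(\mathbb{N}^s)^m$ are related by a permutation if $\alpha_i=\beta_{\pi(i)}$ for some permutation $\pi$ of $[m]$. A caterpillar is a tree whose removal of all leaves leaves a path. For a caterpillar $G$ of diameter $k+1$, fix a longest path $v_1,\dots,v_{k+2}$ and set $\phi(G):[k]\to\mathbb{N}$, $\phi(G)(i)=\deg(v_{i+1})-2$. $\operatorname{aux}(f)$ is $h:\{0,\dots,k+1\}\to\mathbb{Z}$ with $h(0)=h(k+1)=-1$, $h|_{[k]}=f$. For a function $u$ on an integer interval $\{a,\dots,b\}$, its reversal is $u'(i)=u(a+b-i)$; for finite nonempty $S\subset\mathbb{Z}$ with elements $S_1<\dots<S_{|S|}$ contained in the domain, $u|_S(i)=u(S_i)$. The $S$-deck $D_S(u)$ is the multiset in which $g$ has multiplicity $\sum_{i\in\mathbb{Z}}\big(I(i+S\subseteq\operatorname{dom}u,\ u|_{i+S}=g)+I(i+S\subseteq\operatorname{dom}u',\ u'|_{i+S}=g)\big)$. For $g:[s]\to\mathbb{Z}$, $T(g)$ increases $g(1)$ and $g(s)$ by $1$ each (if $s=1$, $T(g)(1)=g(1)+2$); $T(M)$ applies $T$ elementwise to a multiset. For a multiset $M\subset\mathbb{N}^s$, $d(M)$ is the multiset where each $g\in\mathbb{N}^s$ has multiplicity $\sum_{c\in M}F(c,g)$, and $d_\ell(M)$ is its restriction to $g$ with $|g|_1\le\ell$.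 -}

module Defs where

open import Data.Nat as ℕ using (ℕ; zero; suc; _≤_; _<_; _∸_)
open import Data.Nat.Combinatorics using (_C_)
open import Data.Integer as ℤ using (ℤ; +_; -[1+_])
open import Data.Fin as Fin using (Fin; toℕ; fromℕ; inject₁)
open import Data.Bool using (Bool; true; false; if_then_else_)
open import Data.List as List using (List; []; _∷_; _++_)
open import Data.Nat.ListAction using () renaming (sum to lsum)
open import Data.Vec as Vec using (Vec; []; _∷_)
open import Data.Vec.Relation.Unary.All as VAll using (All; all?)
open import Data.Product using (Σ; _×_; ∃; ∃-syntax)
open import Data.Sum using (_⊎_)
open import Relation.Binary.PropositionalEquality using (_≡_)
open import Relation.Nullary using (¬_)
open import Relation.Nullary.Decidable using (_×-dec_)
open import Function.Definitions using (Injective)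
open import Function.Bundles using (_⇔_)
open import Data.Fin.Permutation using (Permutation′; _⟨$⟩ʳ_)

F : ∀ {s} → Vec ℕ s → Vec ℕ s → ℕ
F [] [] = 1
F (x ∷ xs) (i ∷ is) = (x C i) ℕ.* F xs is

norm1 : ∀ {s} → Vec ℕ s → ℕ
norm1 = Vec.sum

RelatedByPerm : ∀ {s m} → Vec (Vec ℕ s) m → Vec (Vec ℕ s) m → Set
RelatedByPerm {m = m} α β =
  ∃ λ (π : Permutation′ m) → ∀ (i : Fin m) → Vec.lookup α i ≡ Vec.lookup β (π ⟨$⟩ʳ i)

momentSum : ∀ {s m} → Vec (Vec ℕ s) m → Vec ℕ s → ℕ
momentSum α i = Vec.sum (Vec.map (λ a → F a i) α)

totalNorm : ∀ {s m} → Vec (Vec ℕ s) m → ℕ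
totalNorm α = Vec.sum (Vec.map norm1 α)

MomentProperty : ℕ → (ℕ → ℕ) → Set
MomentProperty s γ =
  ∀ (m N L : ℕ) (α β : Vec (Vec ℕ s) m) →
  ¬ RelatedByPerm α β →
  totalNorm α ≤ N → totalNorm β ≤ N →
  (∀ (i : Vec ℕ s) → All (_≤ L) i → momentSum α i ≡ momentSum β i) →
  L < γ N

record Graph (n : ℕ) : Set where
  field
    adj    : Fin n → Fin n → Bool
    sym    : ∀ u v → adj u v ≡ adj v u
    irrefl : ∀ u → adj u u ≡ false
open Graph public

Adj : ∀ {n} → Graph n → Fin n → Fin n → Set
Adj G u v = adj G u v ≡ true

deg : ∀ {n} → Graph n → Fin n → ℕ
deg {n} G v = lsum (List.map (λ w → if adj G v w then 1 else 0) (List.allFin n))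

Leaf : ∀ {n} → Graph n → Fin n → Set
Leaf G v = deg G v ≡ 1

IsPath : ∀ {n m} → Graph n → (Fin m → Fin n) → Set
IsPath {m = m} G p =
  Injective _≡_ _≡_ p × (∀ (i j : Fin m) → toℕ j ≡ suc (toℕ i) → Adj G (p i) (p j))

PathOfLength : ∀ {n} → Graph n → Fin n → Fin n → (m : ℕ) → (Fin (suc m) → Fin n) → Set
PathOfLength G u w m p = IsPath G p × p Fin.zero ≡ u × p (fromℕ m) ≡ w

Connected : ∀ {n} → Graph n → Set
Connected G = ∀ u w → ∃ λ m → ∃ λ p → PathOfLength G u w m p

Acyclic : ∀ {n} → Graph n → Set
Acyclic {n} G = ∀ (m : ℕ) (c : Fin (suc (suc (suc m))) → Fin n) →
  IsPath G c → ¬ Adj G (c (fromℕ (suc (suc m)))) (c Fin.zero)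

IsTree : ∀ {n} → Graph n → Set
IsTree G = Connected G × Acyclic G

-- the graph induced on the non-leaves is a path graph w_0 — w_1 — … — w_{r-1}
IsCaterpillar : ∀ {n} → Graph n → Set
IsCaterpillar {n} G = IsTree G ×
  ∃ λ (r : ℕ) → ∃ λ (w : Fin r → Fin n) →
    Injective _≡_ _≡_ w ×
    (∀ i → ¬ Leaf G (w i)) ×
    (∀ v → ¬ Leaf G v → ∃ λ i → w i ≡ v) ×
    (∀ i j → Adj G (w i) (w j) ⇔ (toℕ j ≡ suc (toℕ i) ⊎ toℕ i ≡ suc (toℕ j)))

-- dist(u,w) = length of a shortest path; diameter = max distance
HasDiameter : ∀ {n} → Graph n → ℕ → Set
HasDiameter G D =
  (∀ u w → ∃ λ m → ∃ λ p → PathOfLength G u w m p × m ≤ D) ×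
  (∃ λ u → ∃ λ w → (∃ λ p → PathOfLength G u w D p) ×
     (∀ m p → PathOfLength G u w m p → D ≤ m))

-- v_1, …, v_{k+2} (here indexed 0 … k+1) is a longest path of G
IsLongestPath : ∀ {n k} → Graph n → (Fin (suc (suc k)) → Fin n) → Set
IsLongestPath {n} {k} G v =
  IsPath G v × (∀ (m : ℕ) (p : Fin m → Fin n) → IsPath G p → m ≤ suc (suc k))

-- Functions on integer intervals, represented by their list of values
-- u(a), u(a+1), …, u(b); the deck only depends on this list.

-- φ(G)(i) = deg(v_{i+1}) - 2 for i ∈ [k]  (values φ(1), …, φ(k))
phi : ∀ {n k} → Graph n → (Fin (suc (suc k)) → Fin n) → List ℤ
phi {k = k} G v =
  List.map (λ (i : Fin k) → + deg G (v (Fin.suc (inject₁ i))) ℤ.- + 2) (List.allFin k)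

aux : List ℤ → List ℤ
aux f = (ℤ.- + 1) ∷ (f ++ ((ℤ.- + 1) ∷ []))

-- value at an integer position of the domain {0, …, len-1} (0 outside; never used there)
at : List ℤ → ℤ → ℤ
at [] _ = + 0
at (x ∷ xs) (+ zero) = x
at (x ∷ xs) (+ suc n) = at xs (+ n)
at (x ∷ xs) -[1+ _ ] = + 0

-- S ⊂ ℤ with |S| = s, listed as S_1 < … < S_s
StrictlyIncreasing : ∀ {s} → Vec ℤ s → Set
StrictlyIncreasing {s} S = ∀ (i j : Fin s) → i Fin.< j → Vec.lookup S i ℤ.< Vec.lookup S j

Fits : ∀ {s} → Vec ℤ s → ℕ → ℤ → Set
Fits S len i = All (λ t → + 0 ℤ.≤ i ℤ.+ t × i ℤ.+ t ℤ.< + len) S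

fits? : ∀ {s} (S : Vec ℤ s) (len : ℕ) (i : ℤ) → Relation.Nullary.Dec (Fits S len i)
fits? S len i = all? (λ t → (+ 0 ℤ.≤? i ℤ.+ t) ×-dec (i ℤ.+ t ℤ.<? + len)) S
  where open import Relation.Nullary

-- candidate shifts: all i with 0 ≤ i + S_1 < len (a superset of the valid shifts)
candidates : ∀ {s} → Vec ℤ s → ℕ → List ℤ
candidates [] len = []
candidates (x ∷ _) len = List.map (λ m → + m ℤ.- x) (List.upTo len)

-- the multiset { u|_{i+S} : i ∈ ℤ, i + S ⊆ dom u } as a list
windows : ∀ {s} → Vec ℤ s → List ℤ → List (Vec ℤ s)
windows S u =
  List.map (λ i → Vec.map (λ t → at u (i ℤ.+ t)) S)
           (List.filter (fits? S (List.length u)) (candidates S (List.length u)))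

Deck : ∀ {s} → Vec ℤ s → List ℤ → List (Vec ℤ s)
Deck S u = windows S u ++ windows S (List.reverse u)

-- T: increase first and last entry by 1 (by 2 if s = 1)
incLast : ∀ {s} → Vec ℤ s → Vec ℤ s
incLast [] = []
incLast (x ∷ []) = (x ℤ.+ + 1) ∷ []
incLast (x ∷ y ∷ ys) = x ∷ incLast (y ∷ ys)

Tv : ∀ {s} → Vec ℤ s → Vec ℤ s
Tv [] = []
Tv (x ∷ xs) = incLast ((x ℤ.+ + 1) ∷ xs)

TM : ∀ {s} → List (Vec ℤ s) → List (Vec ℤ s)
TM = List.map Tv

-- d(M): multiplicity of g is Σ_{c ∈ M} F(c, g).  Multisets here have
-- entries in ℤ (they are nonnegative in the application); a negative
-- entry contributes binomial 0.

binomℤ : ℤ → ℕ → ℕ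
binomℤ (+ x) i = x C i
binomℤ -[1+ _ ] i = 0

Fℤ : ∀ {s} → Vec ℤ s → Vec ℕ s → ℕ
Fℤ [] [] = 1
Fℤ (x ∷ xs) (i ∷ is) = binomℤ x i ℕ.* Fℤ xs is

dMult : ∀ {s} → List (Vec ℤ s) → Vec ℕ s → ℕ
dMult M g = lsum (List.map (λ c → Fℤ c g) M)

dℓ-eq : ∀ {s} → ℕ → List (Vec ℤ s) → List (Vec ℤ s) → Set
dℓ-eq {s} ℓ M M' = ∀ (g : Vec ℕ s) → norm1 g ≤ ℓ → dMult M g ≡ dMult M' g

-- The interior vertices of a longest path have degree at least 2, and in an acyclic graph every
-- vertex is adjacent to at most two of them (at most one if it is not one of them), so their
-- degrees sum to at most n + k: f = φ(G) is nonnegative with ‖f‖₁ ≤ n − k.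
-- Cancel the common part of the S-decks D, D̃ of aux f and aux f̃, leaving disjoint multisets
-- A, B.  After T all windows are nonnegative, so d_ℓ(T D) = d_ℓ(T D̃) says that T A and T B have
-- the same moments Σ F(·, i) for |i|₁ ≤ ℓ; the moment i = 0 gives |A| = |B|.  Since |T w|₁ ≤ |w|₁ + 2,
-- every deck has total norm at most B = 2s(‖f‖₁ + 2), and one of A, B avoids the zero window
-- (so has at most B elements), the total norm of T A and of T B is at most 3B = 6s(n − k) + 12s.
-- If A were nonempty the moment property would give γ(3B) < γ(3B); hence D ↭ D̃.  The windows of
-- aux f without an entry −1 are exactly the windows of f, which gives D_S(f) ↭ D_S(f̃).

module Submission where

open import Defs hiding (sym)
open import Data.Nat as ℕ using (ℕ; zero; suc; _≤_; _<_; _∸_; _+_; _*_; z≤n; s≤s)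
import Data.Nat.Properties as ℕP
open import Data.Nat.Combinatorics using (_C_)
open import Data.Nat.ListAction using () renaming (sum to lsum)
open import Data.Nat.ListAction.Properties using (sum-++; sum-↭)
open import Data.Nat.Tactic.RingSolver using (solve-∀)
open import Data.Integer as ℤ using (ℤ; 0ℤ; -1ℤ; -[1+_])
import Data.Integer.Properties as ℤP
import Data.Integer.Tactic.RingSolver as ℤ-Solver
open import Data.Fin as Fin using (Fin; toℕ; fromℕ<; inject₁)
import Data.Fin.Properties as FinP
open import Data.Fin.Permutation using (_⟨$⟩ʳ_)
open import Data.Bool using (Bool; true; false; if_then_else_)
open import Data.Unit using (⊤; tt)
open import Data.Empty using (⊥; ⊥-elim)
open import Data.Product using (_×_; _,_; ∃; proj₁; proj₂)
open import Data.Sum using (_⊎_; inj₁; inj₂)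
open import Data.List as List using (List; []; _∷_; _++_)
import Data.List.Properties as LP
open import Data.List.Membership.Propositional using (_∈_)
import Data.List.Membership.Propositional.Properties as MemP
open import Data.List.Relation.Unary.All as LAll using () renaming (All to LAll)
import Data.List.Relation.Unary.All.Properties as LAllP
open import Data.List.Relation.Unary.Any using (here; there)
open import Data.List.Relation.Binary.Permutation.Propositional using (_↭_; ↭-sym; ↭-trans; ↭-refl; ↭-reflexive; prep)
import Data.List.Relation.Binary.Permutation.Propositional.Properties as PermP
open import Data.Vec as Vec using (Vec; []; _∷_)
import Data.Vec.Properties as VP
open import Data.Vec.Relation.Unary.All as VAll using (All; []; _∷_)
import Data.Vec.Relation.Unary.All.Properties as VAllP
open import Function using (_∘_)
open import Relation.Binary.Definitions using (DecidableEquality; tri<; tri≈; tri>)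
open import Relation.Binary.PropositionalEquality
open import Relation.Nullary using (¬_; Dec; yes; no)
open import Relation.Nullary.Decidable using (does; dec-true; _×-dec_)
open import Algebra.Properties.CommutativeMonoid.Sum ℕP.+-0-commutativeMonoid
  using (sum; sum-syntax; ∑-distrib-+; ∑-comm; sum-cong-≗)
open import Algebra.Properties.AbelianGroup ℤP.+-0-abelianGroup using (∙-cancelʳ)
open import Algebra.Properties.CommutativeSemigroup ℕP.+-commutativeSemigroup using () renaming (interchange to +-interchange)

indicator : Bool → ℕ
indicator b = if b then 1 else 0

sum-mono-≤ : ∀ {n} {f g : Fin n → ℕ} → (∀ i → f i ≤ g i) → sum f ≤ sum g
sum-mono-≤ {zero} _ = z≤n
sum-mono-≤ {suc n} f≤g = ℕP.+-mono-≤ (f≤g Fin.zero) (sum-mono-≤ (f≤g ∘ Fin.suc))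

sum-const : ∀ n c → ∑[ _ < n ] c ≡ n * c
sum-const zero c = refl
sum-const (suc n) c = cong (c +_) (sum-const n c)

sum-one : ∀ n → ∑[ _ < n ] 1 ≡ n
sum-one n = trans (sum-const n 1) (ℕP.*-identityʳ n)

lookup≤sum : ∀ {n} (f : Fin n → ℕ) i → f i ≤ sum f
lookup≤sum f Fin.zero = ℕP.m≤m+n _ _
lookup≤sum f (Fin.suc i) = ℕP.≤-trans (lookup≤sum (f ∘ Fin.suc) i) (ℕP.m≤n+m _ _)

lookup+lookup≤sum : ∀ {n} (f : Fin n → ℕ) {i j} → i ≢ j → f i + f j ≤ sum f
lookup+lookup≤sum f {Fin.zero} {Fin.zero} i≢j = ⊥-elim (i≢j refl)
lookup+lookup≤sum f {Fin.zero} {Fin.suc j} _ = ℕP.+-monoʳ-≤ (f Fin.zero) (lookup≤sum (f ∘ Fin.suc) j)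
lookup+lookup≤sum f {Fin.suc i} {Fin.zero} _ =
  ℕP.≤-trans (ℕP.≤-reflexive (ℕP.+-comm (f (Fin.suc i)) _)) (ℕP.+-monoʳ-≤ (f Fin.zero) (lookup≤sum (f ∘ Fin.suc) i))
lookup+lookup≤sum f {Fin.suc i} {Fin.suc j} i≢j =
  ℕP.≤-trans (lookup+lookup≤sum (f ∘ Fin.suc) (i≢j ∘ cong Fin.suc)) (ℕP.m≤n+m _ _)

sum-indicator-false : ∀ {n} (b : Fin n → Bool) → (∀ i → b i ≡ false) → ∑[ i < n ] indicator (b i) ≡ 0
sum-indicator-false {zero} b _ = refl
sum-indicator-false {suc n} b b≡false rewrite b≡false Fin.zero = sum-indicator-false (b ∘ Fin.suc) (b≡false ∘ Fin.suc)

sum-indicator≤1 : ∀ {n} (b : Fin n → Bool) →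
  (∀ i j → i Fin.< j → b i ≡ true → b j ≡ true → ⊥) → ∑[ i < n ] indicator (b i) ≤ 1
sum-indicator≤1 {zero} b _ = z≤n
sum-indicator≤1 {suc n} b atMostOne with b Fin.zero in b₀
... | true = ℕP.≤-reflexive (cong suc (sum-indicator-false (b ∘ Fin.suc) others-false))
  where
  others-false : ∀ i → b (Fin.suc i) ≡ false
  others-false i with b (Fin.suc i) in bᵢ
  ... | true = ⊥-elim (atMostOne Fin.zero (Fin.suc i) (s≤s z≤n) b₀ bᵢ)
  ... | false = refl
... | false = sum-indicator≤1 (b ∘ Fin.suc) (λ i j i<j → atMostOne (Fin.suc i) (Fin.suc j) (s≤s i<j))

indicator-yes : ∀ {A : Set} (a? : Dec A) → A → indicator (does a?) ≡ 1
indicator-yes a? a = cong indicator (dec-true a? a)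

does≡true⇒ : ∀ {A : Set} (a? : Dec A) → does a? ≡ true → A
does≡true⇒ (yes a) _ = a

sum-indicator-unique≤1 : ∀ {n} {P : Fin n → Set} (P? : ∀ i → Dec (P i)) →
  (∀ {i j} → P i → P j → i ≡ j) → ∑[ i < n ] indicator (does (P? i)) ≤ 1
sum-indicator-unique≤1 P? unique = sum-indicator≤1 _ λ i j i<j Pi Pj →
  ℕP.<-irrefl (cong toℕ (unique (does≡true⇒ (P? i) Pi) (does≡true⇒ (P? j) Pj))) i<j

lsum-tabulate : ∀ {n} (f : Fin n → ℕ) → lsum (List.tabulate f) ≡ sum f
lsum-tabulate {zero} f = refl
lsum-tabulate {suc n} f = cong (f Fin.zero +_) (lsum-tabulate (f ∘ Fin.suc))

-- Interior vertices of a longest path in an acyclic graph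

deg≡sum : ∀ {n} (G : Graph n) u → deg G u ≡ ∑[ w < n ] indicator (adj G u w)
deg≡sum {n} G u = trans (cong lsum (LP.map-tabulate (λ w → w) (indicator ∘ adj G u))) (lsum-tabulate {n} (indicator ∘ adj G u))

Adj-sym : ∀ {n} (G : Graph n) {u w} → Adj G u w → Adj G w u
Adj-sym G {u} {w} uw = trans (Graph.sym G w u) uw

Adj-irrefl : ∀ {n} (G : Graph n) {u} → ¬ Adj G u u
Adj-irrefl G {u} uu with trans (sym uu) (Graph.irrefl G u)
... | ()

<⇒∃+suc : ∀ {a b} → a < b → ∃ λ m → a + suc m ≡ b
<⇒∃+suc {a} a<b with ℕP.m≤n⇒∃[o]m+o≡n a<b
... | m , a+1+m≡b = m , trans (ℕP.+-suc a m) a+1+m≡b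

module AcyclicPath {n N : ℕ} (G : Graph n) (acyclic : Acyclic G) (p : Fin N → Fin n) (isPath : IsPath G p) where

  vertex : (t : ℕ) → .(t < N) → Fin n
  vertex t t<N = p (fromℕ< t<N)

  vertex-cong : ∀ {t t'} .{t<N : t < N} .{t'<N : t' < N} → t ≡ t' → vertex t t<N ≡ vertex t' t'<N
  vertex-cong refl = refl

  vertex-injective : ∀ {t t'} .(t<N : t < N) .(t'<N : t' < N) → vertex t t<N ≡ vertex t' t'<N → t ≡ t'
  vertex-injective t<N t'<N eq = FinP.fromℕ<-injective _ _ t<N t'<N (proj₁ isPath eq)

  vertex-adjacent : ∀ {t} .(t<N : t < N) .(t+1<N : suc t < N) → Adj G (vertex t t<N) (vertex (suc t) t+1<N)
  vertex-adjacent t<N t+1<N =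
    proj₂ isPath _ _ (trans (FinP.toℕ-fromℕ< t+1<N) (cong suc (sym (FinP.toℕ-fromℕ< t<N))))

  ¬adjacent-to-segment-ends : ∀ w a m (a<N : a < N) (b<N : a + suc m < N) →
    (∀ t .(t<N : t < N) → a ≤ t → t ≤ a + suc m → w ≢ vertex t t<N) →
    Adj G w (vertex a a<N) → ¬ Adj G (vertex (a + suc m) b<N) w
  ¬adjacent-to-segment-ends w a m a<N b<N w∉segment w~a b~w =
    acyclic m cycle (cycle-injective , cycle-adjacent)
      (subst (λ u → Adj G u w) (vertex-cong (cong (a +_) (sym (FinP.toℕ-fromℕ (suc m))))) b~w)
    where
    within : ∀ (t : Fin (suc (suc m))) → a + toℕ t ≤ a + suc m
    within t = ℕP.+-monoʳ-≤ a (ℕ.s≤s⁻¹ (FinP.toℕ<n t))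
    bound : ∀ (t : Fin (suc (suc m))) → a + toℕ t < N
    bound t = ℕP.≤-<-trans (within t) b<N
    cycle : Fin (suc (suc (suc m))) → Fin n
    cycle Fin.zero = w
    cycle (Fin.suc t) = vertex (a + toℕ t) (bound t)
    cycle-injective : ∀ {i j} → cycle i ≡ cycle j → i ≡ j
    cycle-injective {Fin.zero} {Fin.zero} _ = refl
    cycle-injective {Fin.zero} {Fin.suc j} eq = ⊥-elim (w∉segment _ (bound j) (ℕP.m≤m+n a _) (within j) eq)
    cycle-injective {Fin.suc i} {Fin.zero} eq = ⊥-elim (w∉segment _ (bound i) (ℕP.m≤m+n a _) (within i) (sym eq))
    cycle-injective {Fin.suc i} {Fin.suc j} eq =
      cong Fin.suc (FinP.toℕ-injective (ℕP.+-cancelˡ-≡ a _ _ (vertex-injective (bound i) (bound j) eq)))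
    cycle-adjacent : ∀ (i j : Fin (suc (suc (suc m)))) → toℕ j ≡ suc (toℕ i) → Adj G (cycle i) (cycle j)
    cycle-adjacent Fin.zero (Fin.suc j) j≡1 =
      subst (Adj G w) (vertex-cong (sym (trans (cong (a +_) (ℕP.suc-injective j≡1)) (ℕP.+-identityʳ a)))) w~a
    cycle-adjacent (Fin.suc i) (Fin.suc j) j≡i+1 =
      subst (Adj G (cycle (Fin.suc i))) (vertex-cong (sym a+j≡a+i+1)) (vertex-adjacent (bound i) (subst (_< N) a+j≡a+i+1 (bound j)))
      where
      a+j≡a+i+1 : a + toℕ j ≡ suc (a + toℕ i)
      a+j≡a+i+1 = trans (cong (a +_) (ℕP.suc-injective j≡i+1)) (ℕP.+-suc a (toℕ i))

  adjacent-before⇒consecutive : ∀ a b (a<N : a < N) (b<N : b < N) → Adj G (vertex a a<N) (vertex b b<N) → a < b → b ≡ suc a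
  adjacent-before⇒consecutive a b a<N b<N a~b a<b with <⇒∃+suc a<b
  ... | zero , a+1≡b = trans (sym a+1≡b) (ℕP.+-comm a 1)
  ... | suc m , a+2+m≡b = ⊥-elim
    (¬adjacent-to-segment-ends (vertex a a<N) (suc a) m a+1<N b'<N a∉segment (vertex-adjacent a<N a+1<N)
      (subst (λ u → Adj G u (vertex a a<N)) (vertex-cong b≡b') (Adj-sym G a~b)))
    where
    b≡b' : b ≡ suc a + suc m
    b≡b' = trans (sym a+2+m≡b) (ℕP.+-suc a (suc m))
    a+1<N : suc a < N
    a+1<N = ℕP.≤-<-trans (subst (suc a ≤_) a+2+m≡b (ℕP.m<m+n a (s≤s z≤n))) b<N
    b'<N : suc a + suc m < N
    b'<N = subst (_< N) b≡b' b<N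
    a∉segment : ∀ t .(t<N : t < N) → suc a ≤ t → t ≤ suc a + suc m → vertex a a<N ≢ vertex t t<N
    a∉segment t t<N a<t _ eq with vertex-injective a<N t<N eq
    ... | refl = ℕP.n≮n a a<t

  adjacent⇒consecutive : ∀ a b (a<N : a < N) (b<N : b < N) → Adj G (vertex a a<N) (vertex b b<N) → b ≡ suc a ⊎ a ≡ suc b
  adjacent⇒consecutive a b a<N b<N a~b with ℕP.<-cmp a b
  ... | tri≈ _ refl _ = ⊥-elim (Adj-irrefl G a~b)
  ... | tri< a<b _ _ = inj₁ (adjacent-before⇒consecutive a b a<N b<N a~b a<b)
  ... | tri> _ _ b<a = inj₂ (adjacent-before⇒consecutive b a b<N a<N (Adj-sym G a~b) b<a)

norm₁ : ∀ {s} → Vec ℤ s → ℕ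
norm₁ w = Vec.sum (Vec.map ℤ.∣_∣ w)

listNorm₁ : List ℤ → ℕ
listNorm₁ u = lsum (List.map ℤ.∣_∣ u)

module Spine {n k : ℕ} (G : Graph n) (acyclic : Acyclic G) (v : Fin (suc (suc k)) → Fin n) (isPath : IsPath G v) where
  open AcyclicPath G acyclic v isPath

  interior : Fin k → Fin n
  interior i = v (Fin.suc (inject₁ i))

  interior< : ∀ (i : Fin k) → suc (toℕ i) < suc (suc k)
  interior< i = s≤s (ℕP.m≤n⇒m≤1+n (FinP.toℕ<n i))

  interior≡vertex : ∀ i → interior i ≡ vertex (suc (toℕ i)) (interior< i)
  interior≡vertex i = cong v (FinP.toℕ-injective (trans (cong suc (FinP.toℕ-inject₁ i)) (sym (FinP.toℕ-fromℕ< (interior< i)))))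

  2≤deg-interior : ∀ i → 2 ≤ deg G (interior i)
  2≤deg-interior i rewrite deg≡sum G (interior i) =
    ℕP.≤-trans (ℕP.≤-reflexive (cong₂ _+_ (sym (neighbour before~)) (sym (neighbour after~))))
               (lookup+lookup≤sum (λ w → indicator (adj G (interior i) w)) before≢after)
    where
    t = toℕ i
    t<N : t < suc (suc k)
    t<N = ℕP.<-trans (FinP.toℕ<n i) (ℕP.<-trans (ℕP.n<1+n k) (ℕP.n<1+n (suc k)))
    t+2<N : suc (suc t) < suc (suc k)
    t+2<N = s≤s (s≤s (FinP.toℕ<n i))
    before = vertex t t<N
    after = vertex (suc (suc t)) t+2<N
    before≢after : before ≢ after
    before≢after eq = ℕP.<-irrefl (vertex-injective t<N t+2<N eq) (ℕP.m<n⇒m<1+n (ℕP.n<1+n t))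
    neighbour : ∀ {w} → Adj G (interior i) w → indicator (adj G (interior i) w) ≡ 1
    neighbour = cong indicator
    before~ : Adj G (interior i) before
    before~ = Adj-sym G (subst (Adj G before) (sym (interior≡vertex i)) (vertex-adjacent t<N (interior< i)))
    after~ : Adj G (interior i) after
    after~ = subst (λ u → Adj G u after) (sym (interior≡vertex i)) (vertex-adjacent (interior< i) t+2<N)

  interior-neighbours : Fin n → ℕ
  interior-neighbours w = ∑[ i < k ] indicator (adj G (interior i) w)

  interior-neighbours-of-interior≤2 : ∀ j → interior-neighbours (interior j) ≤ 2
  interior-neighbours-of-interior≤2 j = begin
      interior-neighbours (interior j)
    ≤⟨ sum-mono-≤ {k} only-consecutive ⟩
      ∑[ i < k ] (indicator (does (after? i)) + indicator (does (before? i)))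
    ≡⟨ ∑-distrib-+ {k} (indicator ∘ does ∘ after?) (indicator ∘ does ∘ before?) ⟩
      ∑[ i < k ] indicator (does (after? i)) + ∑[ i < k ] indicator (does (before? i))
    ≤⟨ ℕP.+-mono-≤ (sum-indicator-unique≤1 after? λ p q → FinP.toℕ-injective (trans p (sym q)))
                   (sum-indicator-unique≤1 before? λ p q → FinP.toℕ-injective (ℕP.suc-injective (trans p (sym q)))) ⟩
      2 ∎
    where
    open ℕP.≤-Reasoning
    after? : ∀ i → Dec (toℕ i ≡ suc (toℕ j))
    after? i = toℕ i ℕP.≟ suc (toℕ j)
    before? : ∀ i → Dec (suc (toℕ i) ≡ toℕ j)
    before? i = suc (toℕ i) ℕP.≟ toℕ j
    only-consecutive : ∀ i → indicator (adj G (interior i) (interior j)) ≤ indicator (does (after? i)) + indicator (does (before? i))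
    only-consecutive i with adj G (interior i) (interior j) in i~j
    ... | false = z≤n
    ... | true with adjacent⇒consecutive (suc (toℕ i)) (suc (toℕ j)) (interior< i) (interior< j)
                      (subst₂ (Adj G) (interior≡vertex i) (interior≡vertex j) i~j)
    ... | inj₁ j≡i+1 = ℕP.≤-trans (ℕP.≤-reflexive (sym (indicator-yes (before? i) (sym (ℕP.suc-injective j≡i+1))))) (ℕP.m≤n+m _ _)
    ... | inj₂ i≡j+1 = ℕP.≤-trans (ℕP.≤-reflexive (sym (indicator-yes (after? i) (ℕP.suc-injective i≡j+1)))) (ℕP.m≤m+n _ _)

  interior-neighbours-off-interior≤1 : ∀ w → (∀ i → interior i ≢ w) → interior-neighbours w ≤ 1
  interior-neighbours-off-interior≤1 w w∉interior = sum-indicator≤1 _ not-two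
    where
    not-two : ∀ i j → i Fin.< j → Adj G (interior i) w → Adj G (interior j) w → ⊥
    not-two i j i<j i~w j~w with <⇒∃+suc (s≤s i<j)
    ... | m , i+1+m≡j =
      ¬adjacent-to-segment-ends w (suc (toℕ i)) m (interior< i) j<N w∉segment
        (Adj-sym G (subst (λ u → Adj G u w) (interior≡vertex i) i~w))
        (subst (λ u → Adj G u w) (trans (interior≡vertex j) (vertex-cong {t<N = interior< j} {t'<N = j<N} (sym i+1+m≡j))) j~w)
      where
      j<N : suc (toℕ i) + suc m < suc (suc k)
      j<N = subst (_< suc (suc k)) (sym i+1+m≡j) (interior< j)
      w∉segment : ∀ t .(t<N : t < suc (suc k)) → suc (toℕ i) ≤ t → t ≤ suc (toℕ i) + suc m → w ≢ vertex t t<N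
      w∉segment (suc t) t<N _ t≤j eq = w∉interior (fromℕ< t<k) (begin
          interior (fromℕ< t<k)
        ≡⟨ interior≡vertex (fromℕ< t<k) ⟩
          vertex (suc (toℕ (fromℕ< t<k))) (interior< _)
        ≡⟨ vertex-cong {t<N = interior< (fromℕ< t<k)} {t'<N = t<N} (cong suc (FinP.toℕ-fromℕ< t<k)) ⟩
          vertex (suc t) t<N
        ≡⟨ sym eq ⟩
          w ∎)
        where
        open ≡-Reasoning
        t<k : t < k
        t<k = ℕP.≤-<-trans (ℕ.s≤s⁻¹ (subst (suc t ≤_) i+1+m≡j t≤j)) (FinP.toℕ<n j)

  interior-neighbours≤ : ∀ w → interior-neighbours w ≤ 1 + ∑[ i < k ] indicator (does (interior i FinP.≟ w))
  interior-neighbours≤ w with FinP.any? (λ i → interior i FinP.≟ w)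
  ... | yes (j , refl) =
    ℕP.≤-trans (interior-neighbours-of-interior≤2 j)
      (s≤s (ℕP.≤-trans (ℕP.≤-reflexive (sym (indicator-yes (interior j FinP.≟ interior j) refl)))
                       (lookup≤sum (λ i → indicator (does (interior i FinP.≟ interior j))) j)))
  ... | no w∉interior = ℕP.≤-trans (interior-neighbours-off-interior≤1 w (λ i eq → w∉interior (i , eq))) (ℕP.m≤m+n 1 _)

  ∑deg-interior≤ : ∑[ i < k ] deg G (interior i) ≤ n + k
  ∑deg-interior≤ = begin
      ∑[ i < k ] deg G (interior i)
    ≡⟨ sum-cong-≗ (deg≡sum G ∘ interior) ⟩
      ∑[ i < k ] ∑[ w < n ] indicator (adj G (interior i) w)
    ≡⟨ ∑-comm (λ i w → indicator (adj G (interior i) w)) ⟩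
      ∑[ w < n ] interior-neighbours w
    ≤⟨ sum-mono-≤ interior-neighbours≤ ⟩
      ∑[ w < n ] (1 + ∑[ i < k ] indicator (does (interior i FinP.≟ w)))
    ≡⟨ ∑-distrib-+ {n} (λ _ → 1) (λ w → ∑[ i < k ] indicator (does (interior i FinP.≟ w))) ⟩
      ∑[ w < n ] 1 + ∑[ w < n ] ∑[ i < k ] indicator (does (interior i FinP.≟ w))
    ≡⟨ cong₂ _+_ (sum-one n) (∑-comm (λ w i → indicator (does (interior i FinP.≟ w)))) ⟩
      n + ∑[ i < k ] ∑[ w < n ] indicator (does (interior i FinP.≟ w))
    ≤⟨ ℕP.+-monoʳ-≤ n (sum-mono-≤ (λ i → sum-indicator-unique≤1 (interior i FinP.≟_) λ eq eq′ → trans (sym eq) eq′)) ⟩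
      n + ∑[ i < k ] 1
    ≡⟨ cong (n +_) (sum-one k) ⟩
      n + k ∎
    where open ℕP.≤-Reasoning

  phi≡tabulate : phi G v ≡ List.tabulate (λ i → ℤ.+ (deg G (interior i) ∸ 2))
  phi≡tabulate = trans (LP.map-tabulate (λ i → i) _)
    (LP.tabulate-cong λ i → trans (ℤP.m-n≡m⊖n (deg G (interior i)) 2) (ℤP.⊖-≥ (2≤deg-interior i)))

  phi-nonneg : LAll (0ℤ ℤ.≤_) (phi G v)
  phi-nonneg rewrite phi≡tabulate = LAllP.tabulate⁺ (λ _ → ℤ.+≤+ z≤n)

  excess : ℕ
  excess = ∑[ i < k ] (deg G (interior i) ∸ 2)

  listNorm₁-phi≡excess : listNorm₁ (phi G v) ≡ excess
  listNorm₁-phi≡excess = begin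
      listNorm₁ (phi G v)
    ≡⟨ cong listNorm₁ phi≡tabulate ⟩
      lsum (List.map ℤ.∣_∣ (List.tabulate (λ i → ℤ.+ (deg G (interior i) ∸ 2))))
    ≡⟨ cong lsum (LP.map-tabulate (λ i → ℤ.+ (deg G (interior i) ∸ 2)) ℤ.∣_∣) ⟩
      lsum (List.tabulate (λ i → deg G (interior i) ∸ 2))
    ≡⟨ lsum-tabulate (λ i → deg G (interior i) ∸ 2) ⟩
      excess ∎
    where open ≡-Reasoning

  excess+k+k≤n+k : excess + k + k ≤ n + k
  excess+k+k≤n+k = begin
      excess + k + k
    ≡⟨ regroup excess k ⟩
      excess + k * 2
    ≡⟨ cong (excess +_) (sym (sum-const k 2)) ⟩
      excess + ∑[ i < k ] 2
    ≡⟨ sym (∑-distrib-+ {k} (λ i → deg G (interior i) ∸ 2) (λ _ → 2)) ⟩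
      ∑[ i < k ] (deg G (interior i) ∸ 2 + 2)
    ≡⟨ sum-cong-≗ (λ i → ℕP.m∸n+n≡m (2≤deg-interior i)) ⟩
      ∑[ i < k ] deg G (interior i)
    ≤⟨ ∑deg-interior≤ ⟩
      n + k ∎
    where
    open ℕP.≤-Reasoning
    regroup : ∀ e k → e + k + k ≡ e + k * 2
    regroup = solve-∀

  listNorm₁-phi≤ : listNorm₁ (phi G v) ≤ n ∸ k
  listNorm₁-phi≤ = subst (_≤ n ∸ k) (sym listNorm₁-phi≡excess)
    (ℕP.m+n≤o⇒m≤o∸n excess (ℕP.+-cancelʳ-≤ k (excess + k) n excess+k+k≤n+k))

lsum-map-++ : ∀ {A : Set} (g : A → ℕ) xs ys → lsum (List.map g (xs ++ ys)) ≡ lsum (List.map g xs) + lsum (List.map g ys)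
lsum-map-++ g xs ys = trans (cong lsum (LP.map-++ g xs ys)) (sum-++ (List.map g xs) (List.map g ys))

lsum-map-↭ : ∀ {A : Set} (g : A → ℕ) {xs ys} → xs ↭ ys → lsum (List.map g xs) ≡ lsum (List.map g ys)
lsum-map-↭ g xs↭ys = sum-↭ (PermP.map⁺ g xs↭ys)

lsum-map-part≤ : ∀ {A : Set} (g : A → ℕ) {xs} ys zs → xs ↭ ys ++ zs → lsum (List.map g zs) ≤ lsum (List.map g xs)
lsum-map-part≤ g ys zs xs↭ = ℕP.≤-trans (ℕP.m≤n+m _ _) (ℕP.≤-reflexive (sym (trans (lsum-map-↭ g xs↭) (lsum-map-++ g ys zs))))

lsum-map-mono-∈ : ∀ {A : Set} {g h : A → ℕ} xs → (∀ {x} → x ∈ xs → g x ≤ h x) → lsum (List.map g xs) ≤ lsum (List.map h xs)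
lsum-map-mono-∈ [] _ = z≤n
lsum-map-mono-∈ (x ∷ xs) g≤h = ℕP.+-mono-≤ (g≤h (here refl)) (lsum-map-mono-∈ xs (g≤h ∘ there))

lsum-map-cong-∈ : ∀ {A : Set} {g h : A → ℕ} xs → (∀ {x} → x ∈ xs → g x ≡ h x) → lsum (List.map g xs) ≡ lsum (List.map h xs)
lsum-map-cong-∈ [] _ = refl
lsum-map-cong-∈ (x ∷ xs) g≡h = cong₂ _+_ (g≡h (here refl)) (lsum-map-cong-∈ xs (g≡h ∘ there))

lsum-map-+ : ∀ {A : Set} (g h : A → ℕ) xs → lsum (List.map (λ x → g x + h x) xs) ≡ lsum (List.map g xs) + lsum (List.map h xs)
lsum-map-+ g h [] = refl
lsum-map-+ g h (x ∷ xs) = trans (cong (g x + h x +_) (lsum-map-+ g h xs)) (+-interchange (g x) (h x) _ _)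

lsum-map-const : ∀ {A : Set} c (xs : List A) → lsum (List.map (λ _ → c) xs) ≡ c * List.length xs
lsum-map-const c [] = sym (ℕP.*-zeroʳ c)
lsum-map-const c (x ∷ xs) = trans (cong (c +_) (lsum-map-const c xs)) (sym (ℕP.*-suc c _))

lsum-filter≤ : ∀ {A : Set} {P : A → Set} (P? : ∀ a → Dec (P a)) (g : A → ℕ) xs →
  lsum (List.map g (List.filter P? xs)) ≤ lsum (List.map g xs)
lsum-filter≤ P? g [] = z≤n
lsum-filter≤ P? g (x ∷ xs) with does (P? x)
... | true = ℕP.+-monoʳ-≤ (g x) (lsum-filter≤ P? g xs)
... | false = ℕP.≤-trans (lsum-filter≤ P? g xs) (ℕP.m≤n+m _ (g x))

lsum-applyUpTo-cong : ∀ {f g : ℕ → ℕ} L → (∀ m → f m ≡ g m) → lsum (List.applyUpTo f L) ≡ lsum (List.applyUpTo g L)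
lsum-applyUpTo-cong zero _ = refl
lsum-applyUpTo-cong (suc L) f≡g = cong₂ _+_ (f≡g 0) (lsum-applyUpTo-cong L (f≡g ∘ suc))

lsum-applyUpTo-zero : ∀ {f : ℕ → ℕ} L → (∀ m → f m ≡ 0) → lsum (List.applyUpTo f L) ≡ 0
lsum-applyUpTo-zero zero _ = refl
lsum-applyUpTo-zero (suc L) f≡0 rewrite f≡0 0 = lsum-applyUpTo-zero L (f≡0 ∘ suc)

vsum-map-zero : ∀ {s} {A : Set} (ys : Vec A s) → Vec.sum (Vec.map (λ _ → 0) ys) ≡ 0
vsum-map-zero [] = refl
vsum-map-zero (_ ∷ ys) = vsum-map-zero ys

vsum-map-+ : ∀ {s} {A : Set} (f g : A → ℕ) (ys : Vec A s) →
  Vec.sum (Vec.map (λ a → f a + g a) ys) ≡ Vec.sum (Vec.map f ys) + Vec.sum (Vec.map g ys)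
vsum-map-+ f g [] = refl
vsum-map-+ f g (y ∷ ys) = trans (cong (f y + g y +_) (vsum-map-+ f g ys)) (+-interchange (f y) (g y) _ _)

vsum-map-≤ : ∀ {s} {A : Set} (f : A → ℕ) B (ys : Vec A s) → (∀ a → f a ≤ B) → Vec.sum (Vec.map f ys) ≤ s * B
vsum-map-≤ f B [] _ = z≤n
vsum-map-≤ f B (y ∷ ys) f≤B = ℕP.+-mono-≤ (f≤B y) (vsum-map-≤ f B ys f≤B)

lsum-vsum-comm : ∀ {s} {A B : Set} (h : A → B → ℕ) xs (ys : Vec B s) →
  lsum (List.map (λ a → Vec.sum (Vec.map (h a) ys)) xs) ≡ Vec.sum (Vec.map (λ b → lsum (List.map (λ a → h a b) xs)) ys)
lsum-vsum-comm h [] ys = sym (vsum-map-zero ys)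
lsum-vsum-comm h (x ∷ xs) ys =
  trans (cong (Vec.sum (Vec.map (h x) ys) +_) (lsum-vsum-comm h xs ys)) (sym (vsum-map-+ (h x) _ ys))

toVec : ∀ {A : Set} (xs : List A) {m} → List.length xs ≡ m → Vec A m
toVec [] refl = []
toVec (x ∷ xs) refl = x ∷ toVec xs refl

vsum-map-toVec : ∀ {A : Set} (h : A → ℕ) xs {m} (len≡m : List.length xs ≡ m) →
  Vec.sum (Vec.map h (toVec xs len≡m)) ≡ lsum (List.map h xs)
vsum-map-toVec h [] refl = refl
vsum-map-toVec h (x ∷ xs) refl = cong (h x +_) (vsum-map-toVec h xs refl)

lookup-toVec-∈ : ∀ {A : Set} (xs : List A) {m} (len≡m : List.length xs ≡ m) j → Vec.lookup (toVec xs len≡m) j ∈ xs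
lookup-toVec-∈ (x ∷ xs) refl Fin.zero = here refl
lookup-toVec-∈ (x ∷ xs) refl (Fin.suc j) = there (lookup-toVec-∈ xs refl j)

no-index⇒[] : ∀ {A : Set} (xs : List A) → (Fin (List.length xs) → ⊥) → xs ≡ []
no-index⇒[] [] _ = refl
no-index⇒[] (_ ∷ _) no-index = ⊥-elim (no-index Fin.zero)

record Difference {X : Set} (xs ys : List X) : Set where
  field
    common onlyˡ onlyʳ : List X
    xs↭ : xs ↭ common ++ onlyˡ
    ys↭ : ys ↭ common ++ onlyʳ
    disjoint : ∀ {z} → z ∈ onlyˡ → z ∈ onlyʳ → ⊥

difference : ∀ {X : Set} → DecidableEquality X → ∀ xs ys → Difference {X} xs ys
difference _≟_ [] ys = record { common = [] ; onlyˡ = [] ; onlyʳ = ys ; xs↭ = ↭-refl ; ys↭ = ↭-refl ; disjoint = λ () }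
difference _≟_ (x ∷ xs) ys with x ∈? ys
  where open import Data.List.Membership.DecPropositional _≟_ using (_∈?_)
... | yes x∈ys with MemP.∈-∃++ x∈ys
...   | ys₁ , ys₂ , refl = record
  { common = x ∷ common ; onlyˡ = onlyˡ ; onlyʳ = onlyʳ
  ; xs↭ = prep x xs↭ ; ys↭ = ↭-trans (PermP.shift x ys₁ ys₂) (prep x ys↭) ; disjoint = disjoint }
  where open Difference (difference _≟_ xs (ys₁ ++ ys₂))
difference _≟_ (x ∷ xs) ys | no x∉ys = record
  { common = common ; onlyˡ = x ∷ onlyˡ ; onlyʳ = onlyʳ
  ; xs↭ = ↭-trans (prep x xs↭) (↭-sym (PermP.shift x common onlyˡ)) ; ys↭ = ys↭ ; disjoint = disjoint′ }
  where
  open Difference (difference _≟_ xs ys)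
  disjoint′ : ∀ {z} → z ∈ x ∷ onlyˡ → z ∈ onlyʳ → ⊥
  disjoint′ (here refl) x∈onlyʳ = x∉ys (PermP.∈-resp-↭ (↭-sym ys↭) (MemP.∈-++⁺ʳ common x∈onlyʳ))
  disjoint′ (there z∈onlyˡ) z∈onlyʳ = disjoint z∈onlyˡ z∈onlyʳ

filter-map-filter : ∀ {A B : Set} {P : B → Set} {Q : A → Set} (P? : ∀ b → Dec (P b)) (Q? : ∀ a → Dec (Q a)) (g : A → B) xs →
  List.filter P? (List.map g (List.filter Q? xs)) ≡ List.map g (List.filter (λ a → Q? a ×-dec P? (g a)) xs)
filter-map-filter P? Q? g [] = refl
filter-map-filter P? Q? g (x ∷ xs) with Q? x
... | no _ = filter-map-filter P? Q? g xs
... | yes _ with P? (g x)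
...   | yes _ = cong (g x ∷_) (filter-map-filter P? Q? g xs)
...   | no _ = filter-map-filter P? Q? g xs

map-filter-map-≡ : ∀ {A B C D : Set} {P₁ : B → Set} {P₂ : C → Set} (P₁? : ∀ b → Dec (P₁ b)) (P₂? : ∀ c → Dec (P₂ c))
  {g₁ : B → D} {g₂ : C → D} {h₁ : A → B} {h₂ : A → C} →
  (∀ a → P₁ (h₁ a) → P₂ (h₂ a)) → (∀ a → P₂ (h₂ a) → P₁ (h₁ a)) → (∀ a → P₂ (h₂ a) → g₁ (h₁ a) ≡ g₂ (h₂ a)) →
  ∀ xs → List.map g₁ (List.filter P₁? (List.map h₁ xs)) ≡ List.map g₂ (List.filter P₂? (List.map h₂ xs))
map-filter-map-≡ P₁? P₂? _ _ _ [] = refl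
map-filter-map-≡ P₁? P₂? {h₁ = h₁} {h₂} to from same (x ∷ xs) with P₁? (h₁ x) | P₂? (h₂ x)
... | yes _ | yes P₂x = cong₂ _∷_ (same x P₂x) (map-filter-map-≡ P₁? P₂? to from same xs)
... | yes P₁x | no ¬P₂x = ⊥-elim (¬P₂x (to x P₁x))
... | no ¬P₁x | yes P₂x = ⊥-elim (¬P₁x (from x P₂x))
... | no _ | no _ = map-filter-map-≡ P₁? P₂? to from same xs

map-upTo-2+ : ∀ {A : Set} (c : ℕ → A) k →
  List.map c (List.upTo (suc (suc k))) ≡ c 0 ∷ (List.map (c ∘ suc) (List.upTo k) ++ c (suc k) ∷ [])
map-upTo-2+ c k = begin
    List.map c (List.upTo (suc (suc k)))
  ≡⟨ LP.map-applyUpTo (λ m → m) c (suc (suc k)) ⟩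
    c 0 ∷ List.applyUpTo (c ∘ suc) (suc k)
  ≡⟨ cong (c 0 ∷_) (sym (LP.applyUpTo-∷ʳ (c ∘ suc) k)) ⟩
    c 0 ∷ (List.applyUpTo (c ∘ suc) k ++ c (suc k) ∷ [])
  ≡⟨ cong (λ xs → c 0 ∷ (xs ++ c (suc k) ∷ [])) (sym (LP.map-applyUpTo (λ m → m) (c ∘ suc) k)) ⟩
    c 0 ∷ (List.map (c ∘ suc) (List.upTo k) ++ c (suc k) ∷ []) ∎
  where open ≡-Reasoning

filter-reject-ends : ∀ {A : Set} {P : A → Set} (P? : ∀ a → Dec (P a)) {x y} xs → ¬ P x → ¬ P y →
  List.filter P? (x ∷ (xs ++ y ∷ [])) ≡ List.filter P? xs
filter-reject-ends P? xs ¬Px ¬Py = begin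
    List.filter P? (_ ∷ (xs ++ _ ∷ []))
  ≡⟨ LP.filter-reject P? ¬Px ⟩
    List.filter P? (xs ++ _ ∷ [])
  ≡⟨ LP.filter-++ P? xs _ ⟩
    List.filter P? xs ++ List.filter P? (_ ∷ [])
  ≡⟨ cong (List.filter P? xs ++_) (LP.filter-reject P? ¬Py) ⟩
    List.filter P? xs ++ []
  ≡⟨ LP.++-identityʳ _ ⟩
    List.filter P? xs ∎
  where open ≡-Reasoning

-- Norms of decks

window : ∀ {s} → Vec ℤ s → List ℤ → ℤ → Vec ℤ s
window S u i = Vec.map (λ t → at u (i ℤ.+ t)) S

at-negative : ∀ u d → at u -[1+ d ] ≡ 0ℤ
at-negative [] d = refl
at-negative (_ ∷ _) d = refl

-- Positions outside the list contribute nothing, since at returns 0 there.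
∑∣at-shifted∣≤listNorm₁ : ∀ u c L → lsum (List.applyUpTo (λ m → ℤ.∣ at u (ℤ.+ m ℤ.+ c) ∣) L) ≤ listNorm₁ u
∑∣at-shifted∣≤listNorm₁ [] c L = ℕP.≤-reflexive (lsum-applyUpTo-zero L (λ _ → refl))
∑∣at-shifted∣≤listNorm₁ (y ∷ u) (ℤ.+ zero) zero = z≤n
∑∣at-shifted∣≤listNorm₁ (y ∷ u) (ℤ.+ zero) (suc L) = ℕP.+-monoʳ-≤ ℤ.∣ y ∣ (∑∣at-shifted∣≤listNorm₁ u (ℤ.+ 0) L)
∑∣at-shifted∣≤listNorm₁ (y ∷ u) (ℤ.+ suc c) L =
  ℕP.≤-trans (ℕP.≤-reflexive (lsum-applyUpTo-cong L λ m → cong (λ p → ℤ.∣ at (y ∷ u) (ℤ.+ p) ∣) (ℕP.+-suc m c)))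
             (ℕP.≤-trans (∑∣at-shifted∣≤listNorm₁ u (ℤ.+ c) L) (ℕP.m≤n+m _ ℤ.∣ y ∣))
∑∣at-shifted∣≤listNorm₁ u -[1+ d ] zero = z≤n
∑∣at-shifted∣≤listNorm₁ u -[1+ zero ] (suc L) rewrite at-negative u 0 =
  ℕP.≤-trans (ℕP.≤-reflexive (lsum-applyUpTo-cong L λ m → cong (λ p → ℤ.∣ at u p ∣)
                (trans (ℤP.⊖-≥ {suc m} {1} (s≤s z≤n)) (cong ℤ.+_ (sym (ℕP.+-identityʳ m))))))
             (∑∣at-shifted∣≤listNorm₁ u (ℤ.+ 0) L)
∑∣at-shifted∣≤listNorm₁ u -[1+ suc d ] (suc L) rewrite at-negative u (suc d) =
  ℕP.≤-trans (ℕP.≤-reflexive (lsum-applyUpTo-cong L λ m → cong (λ p → ℤ.∣ at u p ∣) (ℤP.[1+m]⊖[1+n]≡m⊖n m (suc d))))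
             (∑∣at-shifted∣≤listNorm₁ u -[1+ d ] L)

∑norm₁-windows≤ : ∀ {s} (S : Vec ℤ s) u → lsum (List.map norm₁ (windows S u)) ≤ s * listNorm₁ u
∑norm₁-windows≤ [] u = z≤n
∑norm₁-windows≤ {suc s} S@(x ∷ _) u = begin
    lsum (List.map norm₁ (windows S u))
  ≡⟨ cong lsum (sym (LP.map-∘ (List.filter (fits? S len) candidatesᵤ))) ⟩
    lsum (List.map (norm₁ ∘ window S u) (List.filter (fits? S len) candidatesᵤ))
  ≤⟨ lsum-filter≤ (fits? S len) (norm₁ ∘ window S u) candidatesᵤ ⟩
    lsum (List.map (norm₁ ∘ window S u) candidatesᵤ)
  ≡⟨ cong lsum (LP.map-cong (λ i → cong Vec.sum (sym (VP.map-∘ ℤ.∣_∣ _ S))) candidatesᵤ) ⟩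
    lsum (List.map (λ i → Vec.sum (Vec.map (λ t → ℤ.∣ at u (i ℤ.+ t) ∣) S)) candidatesᵤ)
  ≡⟨ lsum-vsum-comm (λ i t → ℤ.∣ at u (i ℤ.+ t) ∣) candidatesᵤ S ⟩
    Vec.sum (Vec.map (λ t → lsum (List.map (λ i → ℤ.∣ at u (i ℤ.+ t) ∣) candidatesᵤ)) S)
  ≤⟨ vsum-map-≤ _ (listNorm₁ u) S column≤ ⟩
    suc s * listNorm₁ u ∎
  where
  open ℕP.≤-Reasoning
  len = List.length u
  candidatesᵤ = candidates S len
  column≤ : ∀ t → lsum (List.map (λ i → ℤ.∣ at u (i ℤ.+ t) ∣) candidatesᵤ) ≤ listNorm₁ u
  column≤ t = begin
      lsum (List.map (λ i → ℤ.∣ at u (i ℤ.+ t) ∣) (List.map (λ m → ℤ.+ m ℤ.- x) (List.upTo len)))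
    ≡⟨ cong lsum (trans (sym (LP.map-∘ (List.upTo len))) (LP.map-applyUpTo (λ m → m) _ len)) ⟩
      lsum (List.applyUpTo (λ m → ℤ.∣ at u ((ℤ.+ m ℤ.- x) ℤ.+ t) ∣) len)
    ≡⟨ lsum-applyUpTo-cong len (λ m → cong (λ p → ℤ.∣ at u p ∣) (regroup (ℤ.+ m) x t)) ⟩
      lsum (List.applyUpTo (λ m → ℤ.∣ at u (ℤ.+ m ℤ.+ (t ℤ.- x)) ∣) len)
    ≤⟨ ∑∣at-shifted∣≤listNorm₁ u (t ℤ.- x) len ⟩
      listNorm₁ u ∎
    where
    regroup : ∀ m x t → (m ℤ.- x) ℤ.+ t ≡ m ℤ.+ (t ℤ.- x)
    regroup = ℤ-Solver.solve-∀

listNorm₁-reverse : ∀ u → listNorm₁ (List.reverse u) ≡ listNorm₁ u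
listNorm₁-reverse u = lsum-map-↭ ℤ.∣_∣ (PermP.↭-reverse u)

∑norm₁-deck≤ : ∀ {s} (S : Vec ℤ s) u → lsum (List.map norm₁ (Deck S u)) ≤ 2 * (s * listNorm₁ u)
∑norm₁-deck≤ {s} S u = begin
    lsum (List.map norm₁ (Deck S u))
  ≡⟨ lsum-map-++ norm₁ (windows S u) (windows S (List.reverse u)) ⟩
    lsum (List.map norm₁ (windows S u)) + lsum (List.map norm₁ (windows S (List.reverse u)))
  ≤⟨ ℕP.+-mono-≤ (∑norm₁-windows≤ S u) (∑norm₁-windows≤ S (List.reverse u)) ⟩
    s * listNorm₁ u + s * listNorm₁ (List.reverse u)
  ≡⟨ cong (λ r → s * listNorm₁ u + s * r) (listNorm₁-reverse u) ⟩
    s * listNorm₁ u + s * listNorm₁ u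
  ≡⟨ cong (s * listNorm₁ u +_) (sym (ℕP.+-identityʳ _)) ⟩
    2 * (s * listNorm₁ u) ∎
  where open ℕP.≤-Reasoning

-- Windows of aux f

0≤⇒-1≤ : ∀ {x} → 0ℤ ℤ.≤ x → -1ℤ ℤ.≤ x
0≤⇒-1≤ (ℤ.+≤+ _) = ℤ.-≤+

-1≤⇒0≤+1 : ∀ {x} → -1ℤ ℤ.≤ x → 0ℤ ℤ.≤ x ℤ.+ ℤ.+ 1
-1≤⇒0≤+1 {ℤ.+ _} _ = ℤ.+≤+ z≤n
-1≤⇒0≤+1 { -[1+ zero ]} _ = ℤ.+≤+ z≤n
-1≤⇒0≤+1 { -[1+ suc _ ]} (ℤ.-≤- ())

at-++ˡ : ∀ (f ys : List ℤ) q → q < List.length f → at (f ++ ys) (ℤ.+ q) ≡ at f (ℤ.+ q)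
at-++ˡ (x ∷ f) ys zero _ = refl
at-++ˡ (x ∷ f) ys (suc q) (s≤s q<f) = at-++ˡ f ys q q<f

at-++-length : ∀ (f ys : List ℤ) y → at (f ++ y ∷ ys) (ℤ.+ List.length f) ≡ y
at-++-length [] ys y = refl
at-++-length (x ∷ f) ys y = at-++-length f ys y

at-All : ∀ {P : ℤ → Set} → P 0ℤ → ∀ u → LAll P u → ∀ p → P (at u p)
at-All P0 [] _ p = P0
at-All P0 (x ∷ u) (Px LAll.∷ _) (ℤ.+ zero) = Px
at-All P0 (x ∷ u) (_ LAll.∷ Pu) (ℤ.+ suc q) = at-All P0 u Pu (ℤ.+ q)
at-All P0 (x ∷ u) _ -[1+ _ ] = P0

length-aux : ∀ f → List.length (aux f) ≡ suc (suc (List.length f))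
length-aux f = cong suc (trans (LP.length-++ f) (ℕP.+-comm (List.length f) 1))

reverse-aux : ∀ f → List.reverse (aux f) ≡ aux (List.reverse f)
reverse-aux f = trans (LP.unfold-reverse -1ℤ (f ++ -1ℤ ∷ [])) (cong (_++ -1ℤ ∷ []) (LP.reverse-++ f (-1ℤ ∷ [])))

All-reverse : ∀ {P : ℤ → Set} f → LAll P f → LAll P (List.reverse f)
All-reverse f Pf = LAll.tabulate (λ x∈ → LAll.lookup Pf (PermP.∈-resp-↭ (PermP.↭-reverse f) x∈))

listNorm₁-aux : ∀ f → listNorm₁ (aux f) ≡ 2 + listNorm₁ f
listNorm₁-aux f = cong suc (trans (lsum-map-++ ℤ.∣_∣ f (-1ℤ ∷ [])) (ℕP.+-comm _ 1))

-1≤at-aux : ∀ {f} → LAll (0ℤ ℤ.≤_) f → ∀ p → -1ℤ ℤ.≤ at (aux f) p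
-1≤at-aux {f} f≥0 = at-All ℤ.-≤+ (aux f) (ℤP.≤-refl LAll.∷ LAllP.++⁺ (LAll.map 0≤⇒-1≤ f≥0) (ℤP.≤-refl LAll.∷ LAll.[]))

0≤at-aux-inner : ∀ {f} → LAll (0ℤ ℤ.≤_) f →
  ∀ p → 0ℤ ℤ.< p → ℤ.suc p ℤ.< ℤ.+ List.length (aux f) → 0ℤ ℤ.≤ at (aux f) p
0≤at-aux-inner f≥0 (ℤ.+ zero) (ℤ.+<+ ()) _
0≤at-aux-inner {f} f≥0 (ℤ.+ suc q) _ p+1<len =
  subst (0ℤ ℤ.≤_) (sym (at-++ˡ f (-1ℤ ∷ []) q q<f)) (at-All ℤP.≤-refl f f≥0 (ℤ.+ q))
  where
  q<f : q < List.length f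
  q<f = ℕ.s≤s⁻¹ (ℕ.s≤s⁻¹ (subst (suc (suc (suc q)) ≤_) (length-aux f) (ℤP.drop‿+<+ p+1<len)))

-- In aux f the entry −1 occurs only at both ends, so in a window only at its ends, which T raises.
TAdmissible : ∀ {s} → Vec ℤ s → Set
TAdmissible [] = ⊤
TAdmissible (x ∷ []) = -1ℤ ℤ.≤ x
TAdmissible (x ∷ y ∷ ys) = 0ℤ ℤ.≤ x × TAdmissible (y ∷ ys)

incLast-nonneg : ∀ {s} (w : Vec ℤ s) → TAdmissible w → All (0ℤ ℤ.≤_) (incLast w)
incLast-nonneg [] _ = []
incLast-nonneg (x ∷ []) -1≤x = -1≤⇒0≤+1 -1≤x ∷ []
incLast-nonneg (x ∷ y ∷ ys) (0≤x , rest) = 0≤x ∷ incLast-nonneg (y ∷ ys) rest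

Tv-nonneg : ∀ {s} x (xs : Vec ℤ s) → -1ℤ ℤ.≤ x → TAdmissible xs → All (0ℤ ℤ.≤_) (Tv (x ∷ xs))
Tv-nonneg x [] -1≤x _ = incLast-nonneg (x ℤ.+ ℤ.+ 1 ∷ []) (0≤⇒-1≤ (-1≤⇒0≤+1 -1≤x))
Tv-nonneg x (y ∷ ys) -1≤x adm = incLast-nonneg (x ℤ.+ ℤ.+ 1 ∷ y ∷ ys) (-1≤⇒0≤+1 -1≤x , adm)

StrictlyIncreasing-tail : ∀ {s} {x} {xs : Vec ℤ s} → StrictlyIncreasing (x ∷ xs) → StrictlyIncreasing xs
StrictlyIncreasing-tail increasing i j i<j = increasing (Fin.suc i) (Fin.suc j) (s≤s i<j)

nonneg? : ∀ {s} (w : Vec ℤ s) → Dec (All (0ℤ ℤ.≤_) w)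
nonneg? = VAll.all? (0ℤ ℤ.≤?_)

module WindowsOfAux {f : List ℤ} (f≥0 : LAll (0ℤ ℤ.≤_) f) where
  k = List.length f
  u = aux f
  len = List.length u

  window-TAdmissible : ∀ {m} i (ts : Vec ℤ m) → StrictlyIncreasing ts →
    All (λ t → 0ℤ ℤ.< i ℤ.+ t) ts → All (λ t → i ℤ.+ t ℤ.< ℤ.+ len) ts → TAdmissible (window ts u i)
  window-TAdmissible i [] _ _ _ = tt
  window-TAdmissible i (y ∷ []) _ _ _ = -1≤at-aux f≥0 (i ℤ.+ y)
  window-TAdmissible i (y ∷ z ∷ zs) increasing (0<y ∷ 0<zs) (y<len ∷ z<len ∷ zs<len) =
    0≤at-aux-inner f≥0 (i ℤ.+ y) 0<y
      (ℤP.≤-<-trans (ℤP.i<j⇒suc[i]≤j (ℤP.+-monoʳ-< i (increasing Fin.zero (Fin.suc Fin.zero) (s≤s z≤n)))) z<len) ,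
    window-TAdmissible i (z ∷ zs) (StrictlyIncreasing-tail increasing) 0<zs (z<len ∷ zs<len)

  T-windows-nonneg : ∀ {s} (S : Vec ℤ s) → StrictlyIncreasing S → ∀ w → w ∈ windows S u → All (0ℤ ℤ.≤_) (Tv w)
  T-windows-nonneg (x ∷ xs) increasing w w∈ with MemP.∈-map⁻ (window (x ∷ xs) u) w∈
  ... | i , i∈ , refl with proj₂ (MemP.∈-filter⁻ (fits? (x ∷ xs) len) {xs = candidates (x ∷ xs) len} i∈)
  ... | (0≤x , _) ∷ xs-fit =
    Tv-nonneg _ _ (-1≤at-aux f≥0 (i ℤ.+ x))
      (window-TAdmissible i xs (StrictlyIncreasing-tail increasing)
        (VAllP.lookup⁻ (λ j → ℤP.≤-<-trans 0≤x (ℤP.+-monoʳ-< i (increasing Fin.zero (Fin.suc j) (s≤s z≤n)))))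
        (VAll.map proj₂ xs-fit))

  InRange : ℕ → ℤ → Set
  InRange n p = 0ℤ ℤ.≤ p × p ℤ.< ℤ.+ n

  at-aux-suc : ∀ p → InRange k p → at u (p ℤ.+ ℤ.+ 1) ≡ at f p
  at-aux-suc (ℤ.+ q) (_ , ℤ.+<+ q<k) = trans (cong (at u ∘ ℤ.+_) (ℕP.+-comm q 1)) (at-++ˡ f (-1ℤ ∷ []) q q<k)

  inRange-suc : ∀ p → InRange k p → InRange (suc (suc k)) (p ℤ.+ ℤ.+ 1) × 0ℤ ℤ.≤ at u (p ℤ.+ ℤ.+ 1)
  inRange-suc p@(ℤ.+ q) p∈@(_ , ℤ.+<+ q<k) =
    (ℤ.+≤+ z≤n , ℤ.+<+ (subst (_< suc (suc k)) (ℕP.+-comm 1 q) (s≤s (ℕP.m<n⇒m<1+n q<k)))) ,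
    subst (0ℤ ℤ.≤_) (sym (at-aux-suc p p∈)) (at-All ℤP.≤-refl f f≥0 p)

  inRange-pred : ∀ p → InRange (suc (suc k)) (p ℤ.+ ℤ.+ 1) → 0ℤ ℤ.≤ at u (p ℤ.+ ℤ.+ 1) → InRange k p
  inRange-pred (ℤ.+ q) (_ , ℤ.+<+ q+1<k+2) 0≤aₚ with ℕP.<-cmp q k
  ... | tri< q<k _ _ = ℤ.+≤+ z≤n , ℤ.+<+ q<k
  ... | tri≈ _ refl _ with () ← subst (0ℤ ℤ.≤_) (trans (cong (at u ∘ ℤ.+_) (ℕP.+-comm q 1)) (at-++-length f [] -1ℤ)) 0≤aₚ
  ... | tri> _ _ k<q = ⊥-elim (ℕP.<-irrefl refl (ℕP.<-≤-trans q+1<k+2 (subst (_≤ q + 1) (ℕP.+-comm (suc k) 1) (ℕP.+-monoˡ-≤ 1 k<q))))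
  inRange-pred -[1+ zero ] _ ()
  inRange-pred -[1+ suc _ ] (() , _) _

  shift-assoc : ∀ i t → (i ℤ.+ ℤ.+ 1) ℤ.+ t ≡ (i ℤ.+ t) ℤ.+ ℤ.+ 1
  shift-assoc = ℤ-Solver.solve-∀

  fits-suc : ∀ {s} (S : Vec ℤ s) i → Fits S k i →
    Fits S (suc (suc k)) (i ℤ.+ ℤ.+ 1) × All (0ℤ ℤ.≤_) (window S u (i ℤ.+ ℤ.+ 1))
  fits-suc [] i [] = [] , []
  fits-suc (t ∷ S) i (t∈ ∷ S∈) with inRange-suc (i ℤ.+ t) t∈ | fits-suc S i S∈
  ... | t+1∈ , 0≤aₜ | S+1∈ , 0≤a =
    (subst (InRange (suc (suc k))) (sym (shift-assoc i t)) t+1∈ ∷ S+1∈) ,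
    (subst (λ p → 0ℤ ℤ.≤ at u p) (sym (shift-assoc i t)) 0≤aₜ ∷ 0≤a)

  fits-pred : ∀ {s} (S : Vec ℤ s) i →
    Fits S (suc (suc k)) (i ℤ.+ ℤ.+ 1) → All (0ℤ ℤ.≤_) (window S u (i ℤ.+ ℤ.+ 1)) → Fits S k i
  fits-pred [] i [] [] = []
  fits-pred (t ∷ S) i (t+1∈ ∷ S+1∈) (0≤aₜ ∷ 0≤a) =
    inRange-pred (i ℤ.+ t) (subst (InRange (suc (suc k))) (shift-assoc i t) t+1∈)
                           (subst (λ p → 0ℤ ℤ.≤ at u p) (shift-assoc i t) 0≤aₜ)
    ∷ fits-pred S i S+1∈ 0≤a

  window-aux-suc : ∀ {s} (S : Vec ℤ s) i → Fits S k i → window S u (i ℤ.+ ℤ.+ 1) ≡ window S f i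
  window-aux-suc [] i [] = refl
  window-aux-suc (t ∷ S) i (t∈ ∷ S∈) =
    cong₂ _∷_ (trans (cong (at u) (shift-assoc i t)) (at-aux-suc (i ℤ.+ t) t∈)) (window-aux-suc S i S∈)

  -- The window of aux f at candidate m + 1 is the window of f at candidate m; candidates 0 and k + 1
  -- start on an entry −1.
  filter-windows-aux : ∀ {s} (S : Vec ℤ s) → List.filter nonneg? (windows S u) ≡ windows S f
  filter-windows-aux [] = refl
  filter-windows-aux S@(x ∷ _) = begin
      List.filter nonneg? (List.map (window S u) (List.filter (fits? S len) (List.map c (List.upTo len))))
    ≡⟨ cong (λ n → List.filter nonneg? (List.map (window S u) (List.filter (fits? S n) (List.map c (List.upTo n))))) (length-aux f) ⟩
      List.filter nonneg? (List.map (window S u) (List.filter (fits? S (suc (suc k))) (List.map c (List.upTo (suc (suc k))))))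
    ≡⟨ filter-map-filter nonneg? (fits? S (suc (suc k))) (window S u) (List.map c (List.upTo (suc (suc k)))) ⟩
      List.map (window S u) (List.filter R? (List.map c (List.upTo (suc (suc k)))))
    ≡⟨ cong (List.map (window S u) ∘ List.filter R?) (map-upTo-2+ c k) ⟩
      List.map (window S u) (List.filter R? (c 0 ∷ (List.map (c ∘ suc) (List.upTo k) ++ c (suc k) ∷ [])))
    ≡⟨ cong (List.map (window S u)) (filter-reject-ends R? {c 0} {c (suc k)} (List.map (c ∘ suc) (List.upTo k))
                                        (starts-with-1 0 refl) (starts-with-1 (suc k) (at-++-length f [] -1ℤ))) ⟩
      List.map (window S u) (List.filter R? (List.map (c ∘ suc) (List.upTo k)))
    ≡⟨ map-filter-map-≡ R? (fits? S k) to from same (List.upTo k) ⟩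
      List.map (window S f) (List.filter (fits? S k) (List.map c (List.upTo k))) ∎
    where
    open ≡-Reasoning
    c : ℕ → ℤ
    c m = ℤ.+ m ℤ.- x
    c-suc : ∀ m → c (suc m) ≡ c m ℤ.+ ℤ.+ 1
    c-suc m = identity (ℤ.+ m) x
      where
      identity : ∀ a x → (ℤ.+ 1 ℤ.+ a) ℤ.- x ≡ (a ℤ.- x) ℤ.+ ℤ.+ 1
      identity = ℤ-Solver.solve-∀
    c+x : ∀ m → c m ℤ.+ x ≡ ℤ.+ m
    c+x m = identity (ℤ.+ m) x
      where
      identity : ∀ a x → (a ℤ.- x) ℤ.+ x ≡ a
      identity = ℤ-Solver.solve-∀
    R? : ∀ i → Dec (Fits S (suc (suc k)) i × All (0ℤ ℤ.≤_) (window S u i))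
    R? i = fits? S (suc (suc k)) i ×-dec nonneg? (window S u i)
    starts-with-1 : ∀ m → at u (ℤ.+ m) ≡ -1ℤ → ¬ (Fits S (suc (suc k)) (c m) × All (0ℤ ℤ.≤_) (window S u (c m)))
    starts-with-1 m aₘ≡-1 (_ , 0≤a₀ ∷ _) with () ← subst (0ℤ ℤ.≤_) (trans (cong (at u) (c+x m)) aₘ≡-1) 0≤a₀
    to : ∀ m → Fits S (suc (suc k)) (c (suc m)) × All (0ℤ ℤ.≤_) (window S u (c (suc m))) → Fits S k (c m)
    to m (fits , 0≤a) = fits-pred S (c m) (subst (Fits S (suc (suc k))) (c-suc m) fits) (subst (All (0ℤ ℤ.≤_) ∘ window S u) (c-suc m) 0≤a)
    from : ∀ m → Fits S k (c m) → Fits S (suc (suc k)) (c (suc m)) × All (0ℤ ℤ.≤_) (window S u (c (suc m)))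
    from m fits with fits-suc S (c m) fits
    ... | fits′ , 0≤a = subst (Fits S (suc (suc k))) (sym (c-suc m)) fits′ , subst (All (0ℤ ℤ.≤_) ∘ window S u) (sym (c-suc m)) 0≤a
    same : ∀ m → Fits S k (c m) → window S u (c (suc m)) ≡ window S f (c m)
    same m fits = trans (cong (window S u) (c-suc m)) (window-aux-suc S (c m) fits)

T-deck-aux-nonneg : ∀ {s} (S : Vec ℤ s) → StrictlyIncreasing S → ∀ {f} → LAll (0ℤ ℤ.≤_) f →
  ∀ w → w ∈ Deck S (aux f) → All (0ℤ ℤ.≤_) (Tv w)
T-deck-aux-nonneg S increasing {f} f≥0 w w∈ with MemP.∈-++⁻ (windows S (aux f)) w∈
... | inj₁ w∈windows = WindowsOfAux.T-windows-nonneg f≥0 S increasing w w∈windows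
... | inj₂ w∈reversed = WindowsOfAux.T-windows-nonneg (All-reverse f f≥0) S increasing w
                          (subst (λ u → w ∈ windows S u) (reverse-aux f) w∈reversed)

filter-deck-aux : ∀ {s} (S : Vec ℤ s) {f} → LAll (0ℤ ℤ.≤_) f → List.filter nonneg? (Deck S (aux f)) ≡ Deck S f
filter-deck-aux S {f} f≥0 = begin
    List.filter nonneg? (windows S (aux f) ++ windows S (List.reverse (aux f)))
  ≡⟨ LP.filter-++ nonneg? (windows S (aux f)) _ ⟩
    List.filter nonneg? (windows S (aux f)) ++ List.filter nonneg? (windows S (List.reverse (aux f)))
  ≡⟨ cong₂ _++_ (WindowsOfAux.filter-windows-aux f≥0 S)
                (trans (cong (List.filter nonneg? ∘ windows S) (reverse-aux f)) (WindowsOfAux.filter-windows-aux (All-reverse f f≥0) S)) ⟩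
    windows S f ++ windows S (List.reverse f) ∎
  where open ≡-Reasoning

∣x+1∣≤1+∣x∣ : ∀ x → ℤ.∣ x ℤ.+ ℤ.+ 1 ∣ ≤ 1 + ℤ.∣ x ∣
∣x+1∣≤1+∣x∣ x = ℕP.≤-trans (ℤP.∣i+j∣≤∣i∣+∣j∣ x (ℤ.+ 1)) (ℕP.≤-reflexive (ℕP.+-comm ℤ.∣ x ∣ 1))

norm₁-incLast≤ : ∀ {s} (w : Vec ℤ s) → norm₁ (incLast w) ≤ 1 + norm₁ w
norm₁-incLast≤ [] = z≤n
norm₁-incLast≤ (x ∷ []) = ℕP.+-monoˡ-≤ 0 (∣x+1∣≤1+∣x∣ x)
norm₁-incLast≤ (x ∷ y ∷ ys) =
  ℕP.≤-trans (ℕP.+-monoʳ-≤ ℤ.∣ x ∣ (norm₁-incLast≤ (y ∷ ys))) (ℕP.≤-reflexive (ℕP.+-suc ℤ.∣ x ∣ _))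

norm₁-Tv≤ : ∀ {s} (w : Vec ℤ s) → norm₁ (Tv w) ≤ 2 + norm₁ w
norm₁-Tv≤ [] = z≤n
norm₁-Tv≤ (x ∷ xs) = ℕP.≤-trans (norm₁-incLast≤ (x ℤ.+ ℤ.+ 1 ∷ xs)) (s≤s (ℕP.+-monoˡ-≤ (norm₁ xs) (∣x+1∣≤1+∣x∣ x)))

1≤norm₁ : ∀ {s} (w : Vec ℤ s) → w ≢ Vec.replicate s 0ℤ → 1 ≤ norm₁ w
1≤norm₁ [] w≢0 = ⊥-elim (w≢0 refl)
1≤norm₁ (ℤ.+ zero ∷ w) w≢0 = 1≤norm₁ w (w≢0 ∘ cong (0ℤ ∷_))
1≤norm₁ (ℤ.+ suc _ ∷ _) _ = s≤s z≤n
1≤norm₁ (-[1+ _ ] ∷ _) _ = s≤s z≤n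

+1-injective : ∀ {x y} → x ℤ.+ ℤ.+ 1 ≡ y ℤ.+ ℤ.+ 1 → x ≡ y
+1-injective = ∙-cancelʳ (ℤ.+ 1) _ _

incLast-injective : ∀ {s} {v w : Vec ℤ s} → incLast v ≡ incLast w → v ≡ w
incLast-injective {v = []} {[]} _ = refl
incLast-injective {v = x ∷ []} {y ∷ []} eq = cong (_∷ []) (+1-injective (VP.∷-injectiveˡ eq))
incLast-injective {v = x ∷ x' ∷ xs} {y ∷ y' ∷ ys} eq =
  cong₂ _∷_ (VP.∷-injectiveˡ eq) (incLast-injective (VP.∷-injectiveʳ eq))

Tv-injective : ∀ {s} {v w : Vec ℤ s} → Tv v ≡ Tv w → v ≡ w
Tv-injective {v = []} {[]} _ = refl
Tv-injective {v = x ∷ xs} {y ∷ ys} eq with VP.∷-injective (incLast-injective eq)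
... | x+1≡y+1 , xs≡ys = cong₂ _∷_ (+1-injective x+1≡y+1) xs≡ys

map∣∣-injective : ∀ {s} {v w : Vec ℤ s} → All (0ℤ ℤ.≤_) v → All (0ℤ ℤ.≤_) w →
  Vec.map ℤ.∣_∣ v ≡ Vec.map ℤ.∣_∣ w → v ≡ w
map∣∣-injective {v = []} {[]} _ _ _ = refl
map∣∣-injective {v = ℤ.+ _ ∷ _} {ℤ.+ _ ∷ _} (_ ∷ v≥0) (_ ∷ w≥0) eq =
  cong₂ _∷_ (cong ℤ.+_ (VP.∷-injectiveˡ eq)) (map∣∣-injective v≥0 w≥0 (VP.∷-injectiveʳ eq))

Fℤ≡F-map∣∣ : ∀ {s} (c : Vec ℤ s) (g : Vec ℕ s) → All (0ℤ ℤ.≤_) c → Fℤ c g ≡ F (Vec.map ℤ.∣_∣ c) g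
Fℤ≡F-map∣∣ [] [] [] = refl
Fℤ≡F-map∣∣ (ℤ.+ x ∷ c) (i ∷ g) (_ ∷ c≥0) = cong ((x C i) *_) (Fℤ≡F-map∣∣ c g c≥0)

Fℤ-zeros : ∀ {s} (c : Vec ℤ s) → All (0ℤ ℤ.≤_) c → Fℤ c (Vec.replicate s 0) ≡ 1
Fℤ-zeros [] [] = refl
Fℤ-zeros (ℤ.+ x ∷ c) (_ ∷ c≥0) = trans (ℕP.*-identityˡ _) (Fℤ-zeros c c≥0)

norm1-zeros : ∀ s → norm1 (Vec.replicate s 0) ≡ 0
norm1-zeros zero = refl
norm1-zeros (suc s) = norm1-zeros s

norm1-bounded : ∀ {s L} (i : Vec ℕ s) → All (_≤ L) i → norm1 i ≤ s * L
norm1-bounded [] [] = z≤n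
norm1-bounded (x ∷ i) (x≤L ∷ i≤L) = ℕP.+-mono-≤ x≤L (norm1-bounded i i≤L)

-- Reconstruction of the decks

length≤∑norm₁ : ∀ {s} (X : List (Vec ℤ s)) → (∀ {w} → w ∈ X → w ≢ Vec.replicate s 0ℤ) →
  List.length X ≤ lsum (List.map norm₁ X)
length≤∑norm₁ X nonzero = ℕP.≤-trans (ℕP.≤-reflexive (sym (trans (lsum-map-const 1 X) (ℕP.*-identityˡ _))))
                                      (lsum-map-mono-∈ X (λ w∈ → 1≤norm₁ _ (nonzero w∈)))

-- At most one of two disjoint lists contains the zero vector; the other has entries of norm ≥ 1.
length-of-disjoint≤ : ∀ {s} (X Y : List (Vec ℤ s)) B → List.length X ≡ List.length Y → (∀ {w} → w ∈ X → w ∈ Y → ⊥) →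
  lsum (List.map norm₁ X) ≤ B → lsum (List.map norm₁ Y) ≤ B → List.length X ≤ B
length-of-disjoint≤ {s} X Y B |X|≡|Y| disjoint X≤B Y≤B with Vec.replicate s 0ℤ ∈? X
  where open import Data.List.Membership.DecPropositional (VP.≡-dec ℤP._≟_) using (_∈?_)
... | yes 0∈X = ℕP.≤-trans (ℕP.≤-reflexive |X|≡|Y|)
  (ℕP.≤-trans (length≤∑norm₁ Y (λ w∈Y w≡0 → disjoint (subst (_∈ X) (sym w≡0) 0∈X) w∈Y)) Y≤B)
... | no 0∉X = ℕP.≤-trans (length≤∑norm₁ X (λ w∈X w≡0 → 0∉X (subst (_∈ X) w≡0 w∈X))) X≤B

∑norm₁-Tv≤ : ∀ {s} (X : List (Vec ℤ s)) → lsum (List.map (norm₁ ∘ Tv) X) ≤ 2 * List.length X + lsum (List.map norm₁ X)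
∑norm₁-Tv≤ X = begin
    lsum (List.map (norm₁ ∘ Tv) X)
  ≤⟨ lsum-map-mono-∈ X (λ {w} _ → norm₁-Tv≤ w) ⟩
    lsum (List.map (λ w → 2 + norm₁ w) X)
  ≡⟨ lsum-map-+ (λ _ → 2) norm₁ X ⟩
    lsum (List.map (λ _ → 2) X) + lsum (List.map norm₁ X)
  ≡⟨ cong (_+ lsum (List.map norm₁ X)) (lsum-map-const 2 X) ⟩
    2 * List.length X + lsum (List.map norm₁ X) ∎
  where open ℕP.≤-Reasoning

∑norm₁-Tv-of-disjoint≤ : ∀ {s} (X Y : List (Vec ℤ s)) B → List.length X ≡ List.length Y → (∀ {w} → w ∈ X → w ∈ Y → ⊥) →
  lsum (List.map norm₁ X) ≤ B → lsum (List.map norm₁ Y) ≤ B → lsum (List.map (norm₁ ∘ Tv) X) ≤ 3 * B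
∑norm₁-Tv-of-disjoint≤ X Y B |X|≡|Y| disjoint X≤B Y≤B =
  ℕP.≤-trans (∑norm₁-Tv≤ X)
    (ℕP.≤-trans (ℕP.+-mono-≤ (ℕP.*-monoʳ-≤ 2 (length-of-disjoint≤ X Y B |X|≡|Y| disjoint X≤B Y≤B)) X≤B)
                (ℕP.≤-reflexive (2B+B≡3B B)))
  where
  2B+B≡3B : ∀ B → 2 * B + B ≡ 3 * B
  2B+B≡3B = solve-∀

module Reconstruction {s : ℕ} (γ : ℕ → ℕ) (moment-property : MomentProperty s γ)
  (S : Vec ℤ s) (increasing : StrictlyIncreasing S)
  {f f̃ : List ℤ} (f≥0 : LAll (0ℤ ℤ.≤_) f) (f̃≥0 : LAll (0ℤ ℤ.≤_) f̃)
  (Q : ℕ) (f≤Q : listNorm₁ f ≤ Q) (f̃≤Q : listNorm₁ f̃ ≤ Q)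
  (ℓ : ℕ) (ℓ-large : s * γ (6 * s * Q + 12 * s) ≤ ℓ)
  (same-dℓ : dℓ-eq ℓ (TM (Deck S (aux f))) (TM (Deck S (aux f̃)))) where

  N = 6 * s * Q + 12 * s
  L = γ N
  D = Deck S (aux f)
  D̃ = Deck S (aux f̃)

  open Difference (difference (VP.≡-dec ℤP._≟_) D D̃)

  Tmoment : Vec ℕ s → List (Vec ℤ s) → ℕ
  Tmoment g X = lsum (List.map (λ w → Fℤ (Tv w) g) X)

  dMult-TM : ∀ g {X} Y Z → X ↭ Y ++ Z → dMult (TM X) g ≡ Tmoment g Y + Tmoment g Z
  dMult-TM g {X} Y Z X↭ = begin
      lsum (List.map (λ c → Fℤ c g) (List.map Tv X))
    ≡⟨ cong lsum (sym (LP.map-∘ X)) ⟩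
      Tmoment g X
    ≡⟨ lsum-map-↭ (λ w → Fℤ (Tv w) g) X↭ ⟩
      lsum (List.map (λ w → Fℤ (Tv w) g) (Y ++ Z))
    ≡⟨ lsum-map-++ (λ w → Fℤ (Tv w) g) Y Z ⟩
      Tmoment g Y + Tmoment g Z ∎
    where open ≡-Reasoning

  Tmoment-onlyˡ≡onlyʳ : ∀ g → norm1 g ≤ ℓ → Tmoment g onlyˡ ≡ Tmoment g onlyʳ
  Tmoment-onlyˡ≡onlyʳ g g≤ℓ = ℕP.+-cancelˡ-≡ (Tmoment g common) _ _
    (trans (sym (dMult-TM g common onlyˡ xs↭)) (trans (same-dℓ g g≤ℓ) (dMult-TM g common onlyʳ ys↭)))

  T-onlyˡ-nonneg : ∀ {w} → w ∈ onlyˡ → All (0ℤ ℤ.≤_) (Tv w)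
  T-onlyˡ-nonneg w∈ = T-deck-aux-nonneg S increasing f≥0 _ (PermP.∈-resp-↭ (↭-sym xs↭) (MemP.∈-++⁺ʳ common w∈))

  T-onlyʳ-nonneg : ∀ {w} → w ∈ onlyʳ → All (0ℤ ℤ.≤_) (Tv w)
  T-onlyʳ-nonneg w∈ = T-deck-aux-nonneg S increasing f̃≥0 _ (PermP.∈-resp-↭ (↭-sym ys↭) (MemP.∈-++⁺ʳ common w∈))

  Tmoment-zeros : ∀ X → (∀ {w} → w ∈ X → All (0ℤ ℤ.≤_) (Tv w)) → Tmoment (Vec.replicate s 0) X ≡ List.length X
  Tmoment-zeros X T-nonneg =
    trans (lsum-map-cong-∈ X (λ w∈ → Fℤ-zeros _ (T-nonneg w∈))) (trans (lsum-map-const 1 X) (ℕP.*-identityˡ _))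

  length-onlyˡ≡onlyʳ : List.length onlyˡ ≡ List.length onlyʳ
  length-onlyˡ≡onlyʳ = begin
      List.length onlyˡ
    ≡⟨ sym (Tmoment-zeros onlyˡ T-onlyˡ-nonneg) ⟩
      Tmoment (Vec.replicate s 0) onlyˡ
    ≡⟨ Tmoment-onlyˡ≡onlyʳ (Vec.replicate s 0) (subst (_≤ ℓ) (sym (norm1-zeros s)) z≤n) ⟩
      Tmoment (Vec.replicate s 0) onlyʳ
    ≡⟨ Tmoment-zeros onlyʳ T-onlyʳ-nonneg ⟩
      List.length onlyʳ ∎
    where open ≡-Reasoning

  B = 2 * (s * (2 + Q))

  ∑norm₁-deck-aux≤ : ∀ {g} → listNorm₁ g ≤ Q → lsum (List.map norm₁ (Deck S (aux g))) ≤ B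
  ∑norm₁-deck-aux≤ {g} g≤Q = ℕP.≤-trans (∑norm₁-deck≤ S (aux g))
    (ℕP.*-monoʳ-≤ 2 (ℕP.*-monoʳ-≤ s (ℕP.≤-trans (ℕP.≤-reflexive (listNorm₁-aux g)) (ℕP.+-monoʳ-≤ 2 g≤Q))))

  ∑norm₁-onlyˡ≤ : lsum (List.map norm₁ onlyˡ) ≤ B
  ∑norm₁-onlyˡ≤ = ℕP.≤-trans (lsum-map-part≤ norm₁ common onlyˡ xs↭) (∑norm₁-deck-aux≤ f≤Q)

  ∑norm₁-onlyʳ≤ : lsum (List.map norm₁ onlyʳ) ≤ B
  ∑norm₁-onlyʳ≤ = ℕP.≤-trans (lsum-map-part≤ norm₁ common onlyʳ ys↭) (∑norm₁-deck-aux≤ f̃≤Q)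

  3B≡N : 3 * B ≡ N
  3B≡N = identity s Q
    where
    identity : ∀ s Q → 3 * (2 * (s * (2 + Q))) ≡ 6 * s * Q + 12 * s
    identity = solve-∀

  absT : Vec ℤ s → Vec ℕ s
  absT w = Vec.map ℤ.∣_∣ (Tv w)

  vectorOf : ∀ X {m} → List.length X ≡ m → Vec (Vec ℕ s) m
  vectorOf X |X|≡m = toVec (List.map absT X) (trans (LP.length-map absT X) |X|≡m)

  totalNorm-vectorOf : ∀ X {m} (|X|≡m : List.length X ≡ m) → totalNorm (vectorOf X |X|≡m) ≡ lsum (List.map (norm₁ ∘ Tv) X)
  totalNorm-vectorOf X |X|≡m = trans (vsum-map-toVec norm1 (List.map absT X) _) (cong lsum (sym (LP.map-∘ X)))

  momentSum-vectorOf : ∀ X → (∀ {w} → w ∈ X → All (0ℤ ℤ.≤_) (Tv w)) → ∀ {m} (|X|≡m : List.length X ≡ m) i →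
    momentSum (vectorOf X |X|≡m) i ≡ Tmoment i X
  momentSum-vectorOf X T-nonneg |X|≡m i =
    trans (vsum-map-toVec (λ a → F a i) (List.map absT X) _)
          (trans (cong lsum (sym (LP.map-∘ X))) (lsum-map-cong-∈ X (λ w∈ → sym (Fℤ≡F-map∣∣ _ i (T-nonneg w∈)))))

  lookup-vectorOf : ∀ X {m} (|X|≡m : List.length X ≡ m) j → ∃ λ w → w ∈ X × Vec.lookup (vectorOf X |X|≡m) j ≡ absT w
  lookup-vectorOf X |X|≡m j with MemP.∈-map⁻ absT (lookup-toVec-∈ (List.map absT X) _ j)
  ... | w , w∈X , eq = w , w∈X , eq

  α = vectorOf onlyˡ refl
  β = vectorOf onlyʳ (sym length-onlyˡ≡onlyʳ)

  ¬related : Fin (List.length onlyˡ) → ¬ RelatedByPerm α β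
  ¬related j (π , α≡β∘π) with lookup-vectorOf onlyˡ refl j | lookup-vectorOf onlyʳ (sym length-onlyˡ≡onlyʳ) (π ⟨$⟩ʳ j)
  ... | w , w∈ˡ , αⱼ≡ | w̃ , w̃∈ʳ , βπⱼ≡ = disjoint w∈ˡ (subst (_∈ onlyʳ) (sym w≡w̃) w̃∈ʳ)
    where
    w≡w̃ : w ≡ w̃
    w≡w̃ = Tv-injective (map∣∣-injective (T-onlyˡ-nonneg w∈ˡ) (T-onlyʳ-nonneg w̃∈ʳ) (trans (sym αⱼ≡) (trans (α≡β∘π j) βπⱼ≡)))

  onlyˡ-has-no-index : Fin (List.length onlyˡ) → ⊥
  onlyˡ-has-no-index j = ℕP.<-irrefl refl (moment-property _ N L α β (¬related j) α≤N β≤N same-moments)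
    where
    α≤N : totalNorm α ≤ N
    α≤N = ℕP.≤-trans (ℕP.≤-reflexive (totalNorm-vectorOf onlyˡ refl)) (ℕP.≤-trans
            (∑norm₁-Tv-of-disjoint≤ onlyˡ onlyʳ B length-onlyˡ≡onlyʳ disjoint ∑norm₁-onlyˡ≤ ∑norm₁-onlyʳ≤) (ℕP.≤-reflexive 3B≡N))
    β≤N : totalNorm β ≤ N
    β≤N = ℕP.≤-trans (ℕP.≤-reflexive (totalNorm-vectorOf onlyʳ (sym length-onlyˡ≡onlyʳ))) (ℕP.≤-trans
            (∑norm₁-Tv-of-disjoint≤ onlyʳ onlyˡ B (sym length-onlyˡ≡onlyʳ) (λ w∈ʳ w∈ˡ → disjoint w∈ˡ w∈ʳ) ∑norm₁-onlyʳ≤ ∑norm₁-onlyˡ≤)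
            (ℕP.≤-reflexive 3B≡N))
    same-moments : ∀ i → All (_≤ L) i → momentSum α i ≡ momentSum β i
    same-moments i i≤L =
      trans (momentSum-vectorOf onlyˡ T-onlyˡ-nonneg refl i)
        (trans (Tmoment-onlyˡ≡onlyʳ i (ℕP.≤-trans (norm1-bounded i i≤L) ℓ-large))
               (sym (momentSum-vectorOf onlyʳ T-onlyʳ-nonneg _ i)))

  D↭D̃ : D ↭ D̃
  D↭D̃ = ↭-trans xs↭ (↭-trans (↭-reflexive (cong (common ++_) (trans onlyˡ≡[] (sym onlyʳ≡[])))) (↭-sym ys↭))
    where
    onlyˡ≡[] : onlyˡ ≡ []
    onlyˡ≡[] = no-index⇒[] onlyˡ onlyˡ-has-no-index
    onlyʳ≡[] : onlyʳ ≡ []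
    onlyʳ≡[] = no-index⇒[] onlyʳ (onlyˡ-has-no-index ∘ subst Fin (sym length-onlyˡ≡onlyʳ))

decks-of-aux-reconstructed : ∀ {s} (γ : ℕ → ℕ) → MomentProperty s γ →
  (S : Vec ℤ s) → StrictlyIncreasing S →
  ∀ {f f̃} → LAll (0ℤ ℤ.≤_) f → LAll (0ℤ ℤ.≤_) f̃ →
  (Q : ℕ) → listNorm₁ f ≤ Q → listNorm₁ f̃ ≤ Q →
  (ℓ : ℕ) → s * γ (6 * s * Q + 12 * s) ≤ ℓ →
  dℓ-eq ℓ (TM (Deck S (aux f))) (TM (Deck S (aux f̃))) →
  (TM (Deck S (aux f)) ↭ TM (Deck S (aux f̃))) × (Deck S f ↭ Deck S f̃)
decks-of-aux-reconstructed γ moment-property S increasing f≥0 f̃≥0 Q f≤Q f̃≤Q ℓ ℓ-large same-dℓ =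
  PermP.map⁺ Tv D↭D̃ ,
  subst₂ _↭_ (filter-deck-aux S f≥0) (filter-deck-aux S f̃≥0) (PermP.filter-↭ nonneg? D↭D̃)
  where
  open Reconstruction γ moment-property S increasing f≥0 f̃≥0 Q f≤Q f̃≤Q ℓ ℓ-large same-dℓ using (D↭D̃)

proposition4p6 :
    (s : ℕ) → 1 ≤ s → (γ : ℕ → ℕ) → MomentProperty s γ →
    (n k : ℕ) → 1 ≤ k →
    (G G̃ : Graph n) → IsCaterpillar G → IsCaterpillar G̃ →
    HasDiameter G (suc k) → HasDiameter G̃ (suc k) →
    (v ṽ : Fin (suc (suc k)) → Fin n) → IsLongestPath G v → IsLongestPath G̃ ṽ →
    (S : Vec ℤ s) → StrictlyIncreasing S →
    (ℓ : ℕ) → s * γ (6 * s * (n ∸ k) + 12 * s) ≤ ℓ →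
    dℓ-eq ℓ (TM (Deck S (aux (phi G v)))) (TM (Deck S (aux (phi G̃ ṽ)))) →
    (TM (Deck S (aux (phi G v))) ↭ TM (Deck S (aux (phi G̃ ṽ))))
      × (Deck S (phi G v) ↭ Deck S (phi G̃ ṽ))
proposition4p6 s _ γ moment-property n k _ G G̃ ((_ , acyclic) , _) ((_ , acyclic̃) , _) _ _
               v ṽ (path , _) (path̃ , _) S increasing ℓ ℓ-large =
  decks-of-aux-reconstructed γ moment-property S increasing
    (Spine.phi-nonneg G acyclic v path) (Spine.phi-nonneg G̃ acyclic̃ ṽ path̃)
    (n ∸ k) (Spine.listNorm₁-phi≤ G acyclic v path) (Spine.listNorm₁-phi≤ G̃ acyclic̃ ṽ path̃)
    ℓ ℓ-large
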